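{- Let $k\ge2$, and let $1\le m\leq k-1$ and $n\ge m$ be integers. Then $$h_k(m,n) = \sum_{r=1}^m s(m,r)\, f_k(n-m+r),$$ where $h_k(m,n)$ is the number of $k$-front noncrossing partitions of $[n]$ in which each of $1,\dots,m$ is a head, and $f_k(j)$ is the number of $k$-front noncrossing partitions of $[j]$.
   Context: A partition of $[n]$ is a set of pairwise disjoint nonempty blocks with union $[n]$ ($[0]=\emptyset$ has one partition). A head is the smallest element of a block. A front edge is a pair $(i,j)$, $i<j$, in the same block with $i$ the head of that block. A $k$-front crossing is a pair of front edges $(i_1,j_1),(i_2,j_2)$ with $i_1<i_2<j_1<j_2$ and at least $k-2$ heads $h$ with $i_2<h<j_1$; a partition is $k$-front noncrossing if it has none. $s(m,r)$ is $(-1)^{m-r}$ times the number of permutations of $[m]$ with $r$ cycles. -}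

module Defs where

open import Data.Nat using (ℕ; zero; suc; _+_; _∸_; _<ᵇ_; _≤ᵇ_)
open import Data.Bool using (Bool; true; false; _∧_; _∨_; not; if_then_else_)
open import Data.Fin using (Fin; toℕ)
open import Data.List using (List; []; _∷_; map; concatMap; filter; length; allFin; upTo)
open import Data.Bool.ListAction using (all; any)
open import Data.Vec using (Vec; []; _∷_; lookup)
open import Data.Integer using (ℤ; +_; -_; _*_) renaming (_+_ to _+ℤ_)
open import Data.Fin using (_≟_)
open import Relation.Nullary.Decidable using (⌊_⌋)
open import Function using (_∘_)
open import Relation.Unary using (Decidable)
open import Data.Bool using (T)
open import Data.Bool.Properties using (T?)

allVecs : {A : Set} → (n : ℕ) → List A → List (Vec A n)
allVecs zero    xs = [] ∷ []
allVecs (suc n) xs = concatMap (λ x → map (x ∷_) (allVecs n xs)) xs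

count : {A : Set} → (A → Bool) → List A → ℕ
count p xs = length (filter (T? ∘ p) xs)

∀F : (n : ℕ) → (Fin n → Bool) → Bool
∀F n p = all p (allFin n)

∃F : (n : ℕ) → (Fin n → Bool) → Bool
∃F n p = any p (allFin n)

_<F_ : {n : ℕ} → Fin n → Fin n → Bool
i <F j = toℕ i <ᵇ toℕ j

_⇒_ : Bool → Bool → Bool
a ⇒ b = not a ∨ b

-- Set partitions of [n], represented as equivalence relations on
-- Fin n (element i : Fin n stands for i+1 ∈ [n]), given by their
-- boolean relation matrix. The blocks are the equivalence classes.

Rel : ℕ → Set
Rel n = Vec (Vec Bool n) n

_~[_]_ : {n : ℕ} → Fin n → Rel n → Fin n → Bool
i ~[ R ] j = lookup (lookup R i) j

isPartition : (n : ℕ) → Rel n → Bool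
isPartition n R =
  ∀F n (λ i → i ~[ R ] i) ∧
  ∀F n (λ i → ∀F n (λ j → (i ~[ R ] j) ⇒ (j ~[ R ] i))) ∧
  ∀F n (λ i → ∀F n (λ j → ∀F n (λ l →
      ((i ~[ R ] j) ∧ (j ~[ R ] l)) ⇒ (i ~[ R ] l))))

isHead : (n : ℕ) → Rel n → Fin n → Bool
isHead n R h = ∀F n (λ i → (i <F h) ⇒ not (i ~[ R ] h))

isFrontEdge : (n : ℕ) → Rel n → Fin n → Fin n → Bool
isFrontEdge n R i j = (i <F j) ∧ (i ~[ R ] j) ∧ isHead n R i

headsBetween : (n : ℕ) → Rel n → Fin n → Fin n → ℕ
headsBetween n R a b = count (λ h → (a <F h) ∧ (h <F b) ∧ isHead n R h) (allFin n)

hasFrontCrossing : (k n : ℕ) → Rel n → Bool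
hasFrontCrossing k n R =
  ∃F n (λ i₁ → ∃F n (λ i₂ → ∃F n (λ j₁ → ∃F n (λ j₂ →
    (i₁ <F i₂) ∧ (i₂ <F j₁) ∧ (j₁ <F j₂) ∧
    isFrontEdge n R i₁ j₁ ∧ isFrontEdge n R i₂ j₂ ∧
    ((k ∸ 2) ≤ᵇ headsBetween n R i₂ j₁)))))

isKFrontNoncrossing : (k n : ℕ) → Rel n → Bool
isKFrontNoncrossing k n R = not (hasFrontCrossing k n R)

allRels : (n : ℕ) → List (Rel n)
allRels n = allVecs n (allVecs n (true ∷ false ∷ []))

f : (k n : ℕ) → ℕ
f k n = count (λ R → isPartition n R ∧ isKFrontNoncrossing k n R) (allRels n)

h : (k m n : ℕ) → ℕ
h k m n = count (λ R → isPartition n R ∧ isKFrontNoncrossing k n R ∧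
                       ∀F n (λ i → (toℕ i <ᵇ m) ⇒ isHead n R i))
                (allRels n)

_==F_ : {m : ℕ} → Fin m → Fin m → Bool
i ==F j = ⌊ i ≟ j ⌋

isPerm : (m : ℕ) → Vec (Fin m) m → Bool
isPerm m σ = ∀F m (λ i → ∀F m (λ j → (lookup σ i ==F lookup σ j) ⇒ (i ==F j)))

iter : {m : ℕ} → Vec (Fin m) m → ℕ → Fin m → Fin m
iter σ zero    i = i
iter σ (suc t) i = lookup σ (iter σ t i)

isCycleMin : (m : ℕ) → Vec (Fin m) m → Fin m → Bool
isCycleMin m σ i = all (λ t → toℕ i ≤ᵇ toℕ (iter σ t i)) (upTo m)

-- number of cycles = number of cycle minima
cycles : (m : ℕ) → Vec (Fin m) m → ℕ
cycles m σ = count (isCycleMin m σ) (allFin m)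

permsWithCycles : (m r : ℕ) → ℕ
permsWithCycles m r =
  count (λ σ → isPerm m σ ∧ ⌊ cycles m σ Data.Nat.≟ r ⌋) (allVecs m (allFin m))

sign : ℕ → ℤ
sign zero          = + 1
sign (suc zero)    = - (+ 1)
sign (suc (suc e)) = sign e

s : (m r : ℕ) → ℤ
s m r = sign (m ∸ r) * (+ permsWithCycles m r)

sum1to : ℕ → (ℕ → ℤ) → ℤ
sum1to zero    g = + 0
sum1to (suc m) g = sum1to m g +ℤ g (suc m)

-- Write M for the point m+1 of [n+1], where m ≤ n and m ≤ k-2.  A k-front noncrossing partition of [n+1] in
-- which 1,…,m are heads either also has M as a head, or M lies in the block of one of the heads c ≤ m.  Deleting
-- M maps the latter bijectively onto pairs (c, π) with π counted by h_k(m, n); no k-front crossing passes through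
-- M, since M is no head, j₂ = M would make the point j₁ < M a non-head, and j₁ = M would need k-2 heads below M,
-- where there are fewer than m.  Hence h_k(m, n+1) = h_k(m+1, n+1) + m h_k(m, n).  Inserting m+1 into a
-- permutation of [m], as a fixed point or right after one of the m points, gives c(m+1, r+1) = c(m, r) + m c(m, r+1)
-- for the number c(m, r) of permutations of [m] with r cycles, i.e. s(m+1, r+1) = s(m, r) - m s(m, r+1).  The two
-- recurrences match, so the formula follows by induction on m from h_k(1, n) = f_k(n).

module Submission where

open import Defs

open import Data.Bool using (Bool; true; false; _∧_; not; T; if_then_else_)
open import Data.Bool.Properties using (T?; T-irrelevant; T-∧; ∧-zeroʳ; ∧-identityʳ)
open import Data.Empty using (⊥; ⊥-elim)
open import Data.Fin using (Fin; zero; suc; toℕ; punchIn; punchOut; fromℕ; fromℕ<)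
import Data.Fin as Fin
open import Data.Fin.Properties
  using (toℕ-injective; toℕ<n; toℕ-fromℕ; toℕ-fromℕ<; punchInᵢ≢i; punchIn-punchOut; punchOut-punchIn; punchOut-cong;
         punchIn-injective; any?; pigeonhole)
open import Data.Integer using (ℤ; +_; -_; _-_; _*_) renaming (_+_ to _+ℤ_)
import Data.Integer.Properties as ℤ
open import Data.Integer.Tactic.RingSolver using (solve-∀)
open import Data.List
  using (List; []; _∷_; map; filter; length; _++_; allFin; upTo; cartesianProduct; cartesianProductWith;
         concatMap)
import Data.List as List
open import Data.List.Membership.Propositional using (_∈_; lose)
open import Data.List.Membership.Propositional.Properties
  using (∈-∃++; ∈-filter⁺; ∈-allFin; ∈-upTo⁺; ∈-cartesianProductWith⁺; ∈-cartesianProduct⁺)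
open import Data.List.Properties using (length-++; filter-++; filter-≐; map-tabulate; length-upTo; length-tabulate)
open import Data.List.Relation.Unary.All as All using ([]; _∷_)
open import Data.List.Relation.Unary.All.Properties using (all⁺; all⁻)
open import Data.List.Relation.Unary.AllPairs using ([]; _∷_)
open import Data.List.Relation.Unary.Any using (here; there; satisfied)
open import Data.List.Relation.Unary.Any.Properties using (any⁺; any⁻)
open import Data.List.Relation.Unary.Unique.Propositional using (Unique)
open import Data.List.Relation.Unary.Unique.Propositional.Properties using (allFin⁺; cartesianProduct⁺; cartesianProductWith⁺)
open import Data.Maybe using (Maybe; just; nothing; maybe; fromMaybe)
open import Data.Nat using (ℕ; zero; suc; _+_; _≤_; _<_; _∸_; _<ᵇ_; _≤ᵇ_; _≟_; z≤n; s≤s) renaming (_*_ to _*ℕ_)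
open import Data.Nat.DivMod using (_%_; _/_; m≡m%n+[m/n]*n; m%n<n)
open import Data.Nat.Properties
  using (+-commutativeSemigroup; +-suc; +-comm; +-assoc; +-∸-assoc; *-zeroʳ; ≤-refl; ≤-trans; ≤-antisym; ≤-pred;
         <-trans; <-irrefl; <-cmp; ≤-<-trans; <-≤-trans; <⇒≤; ≮⇒≥; n<1+n; n≤1+n; m≤n⇒m≤1+n; m<n⇒m<1+n;
         m≤n⇒m<n∨m≡n; m<n⇒0<n∸m; m∸n≤m;
         m+[n∸m]≡n; ∸-monoˡ-<; ∸-cancelʳ-≡; suc-injective; <ᵇ⇒<; <⇒<ᵇ; ≤ᵇ⇒≤; ≤⇒≤ᵇ; _<?_)
open import Algebra.Properties.CommutativeSemigroup +-commutativeSemigroup using (x∙yz≈y∙xz)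
open import Data.Product using (Σ; ∃; _×_; _,_; proj₁; proj₂)
open import Data.Sum using (_⊎_; inj₁; inj₂; [_,_]′)
open import Data.Unit using (tt)
open import Data.Vec using (Vec; []; _∷_; lookup; tabulate)
open import Data.Vec.Properties using (lookup∘tabulate; tabulate∘lookup; tabulate-cong; ∷-injective)
open import Function using (_∘_)
open import Function.Bundles using (Equivalence)
open import Function.Definitions using (Injective)
open import Relation.Binary.Definitions using (tri<; tri≈; tri>)
open import Relation.Binary.PropositionalEquality
  using (_≡_; _≢_; refl; sym; trans; cong; cong₂; subst; subst₂; module ≡-Reasoning)
open import Relation.Nullary using (¬_; Dec; yes; no)
open import Relation.Nullary.Decidable using (⌊_⌋; toWitness; fromWitness; _×-dec_)
open import Relation.Unary using (_≐_)

open Equivalence using (to; from)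
open ≡-Reasoning

private variable A B : Set

count-∷ : (p : A → Bool) (x : A) (xs : List A) → count p (x ∷ xs) ≡ (if p x then 1 else 0) + count p xs
count-∷ p x xs with p x
... | true  = refl
... | false = refl

count-++ : (p : A → Bool) (xs ys : List A) → count p (xs ++ ys) ≡ count p xs + count p ys
count-++ p xs ys = trans (cong length (filter-++ (T? ∘ p) xs ys)) (length-++ (filter (T? ∘ p) xs))

count-map : (p : B → Bool) (g : A → B) (xs : List A) → count p (map g xs) ≡ count (p ∘ g) xs
count-map p g []       = refl
count-map p g (x ∷ xs)
  rewrite count-∷ p (g x) (map g xs) | count-∷ (p ∘ g) x xs | count-map p g xs with p (g x)
... | true  = refl
... | false = refl

count-≐ : {p q : A → Bool} → (T ∘ p) ≐ (T ∘ q) → (xs : List A) → count p xs ≡ count q xs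
count-≐ {p = p} {q} p≐q xs = cong length (filter-≐ (T? ∘ p) (T? ∘ q) p≐q xs)

count-false : (xs : List A) → count (λ _ → false) xs ≡ 0
count-false []       = refl
count-false (_ ∷ xs) = count-false xs

count-true : (xs : List A) → count (λ _ → true) xs ≡ length xs
count-true []       = refl
count-true (_ ∷ xs) = cong suc (count-true xs)

count-cong : {p q : A → Bool} → (∀ x → p x ≡ q x) → (xs : List A) → count p xs ≡ count q xs
count-cong p≗q = count-≐ ((λ {x} → subst T (p≗q x)) , (λ {x} → subst T (sym (p≗q x))))

count-∧-split : (p q : A → Bool) (xs : List A) →
  count p xs ≡ count (λ x → p x ∧ q x) xs + count (λ x → p x ∧ not (q x)) xs
count-∧-split p q [] = refl
count-∧-split p q (x ∷ xs)
  rewrite count-∷ p x xs | count-∷ (λ x → p x ∧ q x) x xs | count-∷ (λ x → p x ∧ not (q x)) x xs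
        | count-∧-split p q xs
  with p x | q x
... | true  | true  = refl
... | true  | false = sym (+-suc _ _)
... | false | _     = refl

count-cartesianProduct : {A B : Set} (p : A → Bool) (q : B → Bool) (xs : List A) (ys : List B) →
  count (λ xy → p (proj₁ xy) ∧ q (proj₂ xy)) (cartesianProduct xs ys) ≡ count p xs *ℕ count q ys
count-cartesianProduct p q []       ys = refl
count-cartesianProduct {A} {B} p q (x ∷ xs) ys = begin
  count pq (map (x ,_) ys ++ cartesianProduct xs ys)        ≡⟨ count-++ pq (map (x ,_) ys) _ ⟩
  count pq (map (x ,_) ys) + count pq (cartesianProduct xs ys)
    ≡⟨ cong₂ _+_ (count-map pq (x ,_) ys) (count-cartesianProduct p q xs ys) ⟩
  count (λ y → p x ∧ q y) ys + count p xs *ℕ count q ys      ≡⟨ head-row (p x) refl ⟩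
  count p (x ∷ xs) *ℕ count q ys                             ∎
  where
  pq : A × B → Bool
  pq xy = p (proj₁ xy) ∧ q (proj₂ xy)
  head-row : (b : Bool) → p x ≡ b →
    count (λ y → b ∧ q y) ys + count p xs *ℕ count q ys ≡ count p (x ∷ xs) *ℕ count q ys
  head-row true  px rewrite count-∷ p x xs | px = refl
  head-row false px rewrite count-∷ p x xs | px = cong (_+ count p xs *ℕ count q ys) (count-false ys)

unique-⊆⇒length-≤ : {xs ys : List A} → Unique xs → (∀ {z} → z ∈ xs → z ∈ ys) → length xs ≤ length ys
unique-⊆⇒length-≤ {xs = []}     _          _  = z≤n
unique-⊆⇒length-≤ {xs = x ∷ xs} (x∉ ∷ xs!) xs⊆ with ∈-∃++ (xs⊆ (here refl))
... | us , vs , refl = subst (suc (length xs) ≤_) (sym length-split)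
  (s≤s (unique-⊆⇒length-≤ xs! (λ z∈ → drop us (λ z≡x → All.lookup x∉ z∈ (sym z≡x)) (xs⊆ (there z∈)))))
  where
  length-split : length (us ++ x ∷ vs) ≡ suc (length (us ++ vs))
  length-split = trans (length-++ us) (trans (+-suc _ _) (cong suc (sym (length-++ us))))
  drop : ∀ {z} (ws : List _) → z ≢ x → z ∈ ws ++ x ∷ vs → z ∈ ws ++ vs
  drop []       z≢x (here z≡x) = ⊥-elim (z≢x z≡x)
  drop []       _   (there z∈) = z∈
  drop (_ ∷ ws) _   (here z≡w) = here z≡w
  drop (_ ∷ ws) z≢x (there z∈) = there (drop ws z≢x z∈)

module _ {p : A → Bool} (f : ∀ x → T (p x) → B) where

  private
    consIf : (x : A) (b : Bool) → p x ≡ b → List B → List B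
    consIf x true  px ys = f x (subst T (sym px) tt) ∷ ys
    consIf x false _  ys = ys

    images : List A → List B
    images []       = []
    images (x ∷ xs) = consIf x (p x) refl (images xs)

    length-images : ∀ xs → length (images xs) ≡ count p xs
    length-images []       = refl
    length-images (x ∷ xs) = trans (length-consIf (p x) refl) (sym (count-∷ p x xs))
      where
      length-consIf : (b : Bool) (px : p x ≡ b) →
        length (consIf x b px (images xs)) ≡ (if b then 1 else 0) + count p xs
      length-consIf true  _ = cong suc (length-images xs)
      length-consIf false _ = length-images xs

    ∈-images⁻ : ∀ xs {y} → y ∈ images xs → Σ A λ x → Σ (T (p x)) λ px → x ∈ xs × y ≡ f x px
    ∈-images⁻ (x ∷ xs) = ∈-consIf (p x) refl
      where
      ∈-consIf : ∀ {y} (b : Bool) (px : p x ≡ b) → y ∈ consIf x b px (images xs) →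
        Σ A λ x' → Σ (T (p x')) λ px' → x' ∈ x ∷ xs × y ≡ f x' px'
      ∈-consIf true  px (here y≡)  = x , _ , here refl , y≡
      ∈-consIf true  _  (there y∈) = let x' , px' , x'∈ , y≡ = ∈-images⁻ xs y∈ in x' , px' , there x'∈ , y≡
      ∈-consIf false _  y∈         = let x' , px' , x'∈ , y≡ = ∈-images⁻ xs y∈ in x' , px' , there x'∈ , y≡

    images-unique : (∀ x x' px px' → f x px ≡ f x' px' → x ≡ x') → ∀ {xs} → Unique xs → Unique (images xs)
    images-unique f-injective {[]}     _          = []
    images-unique f-injective {x ∷ xs} (x∉ ∷ xs!) = unique-consIf (p x) refl
      where
      unique-consIf : (b : Bool) (px : p x ≡ b) → Unique (consIf x b px (images xs))
      unique-consIf true  _ = All.tabulate (λ y∈ fx≡y → let x' , px' , x'∈ , y≡ = ∈-images⁻ xs y∈ in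
                                All.lookup x∉ x'∈ (f-injective _ _ _ _ (trans fx≡y y≡)))
                              ∷ images-unique f-injective xs!
      unique-consIf false _ = images-unique f-injective xs!

  count-≤-injection : {q : B → Bool} {xs : List A} {zs : List B} → Unique xs →
    (∀ x px → f x px ∈ zs) → (∀ x px → T (q (f x px))) →
    (∀ x x' px px' → f x px ≡ f x' px' → x ≡ x') → count p xs ≤ count q zs
  count-≤-injection {q} {xs} {zs} xs! f∈ qf f-injective =
    subst (_≤ count q zs) (length-images xs)
      (unique-⊆⇒length-≤ (images-unique f-injective xs!) λ y∈ →
        let x , px , _ , y≡ = ∈-images⁻ xs y∈ in
        subst (_∈ filter (T? ∘ q) zs) (sym y≡) (∈-filter⁺ (T? ∘ q) (f∈ x px) (qf x px)))

module _ {p : A → Bool} {q : B → Bool}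
  (f : ∀ x → T (p x) → B) (g : ∀ y → T (q y) → A)
  (q∘f : ∀ x px → T (q (f x px))) (p∘g : ∀ y qy → T (p (g y qy)))
  (g∘f : ∀ x px qfx → g (f x px) qfx ≡ x) (f∘g : ∀ y qy pgy → f (g y qy) pgy ≡ y) where

  count-≡-by-inverses : {xs : List A} {ys : List B} → Unique xs → Unique ys →
    (∀ x → x ∈ xs) → (∀ y → y ∈ ys) → count p xs ≡ count q ys
  count-≡-by-inverses xs! ys! all∈xs all∈ys = ≤-antisym
    (count-≤-injection f xs! (λ x _ → all∈ys _) q∘f λ x x' px px' fx≡fx' →
      trans (sym (g∘f x px (q∘f x px))) (trans (g-cong fx≡fx') (g∘f x' px' (q∘f x' px'))))
    (count-≤-injection g ys! (λ y _ → all∈xs _) p∘g λ y y' qy qy' gy≡gy' →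
      trans (sym (f∘g y qy (p∘g y qy))) (trans (f-cong gy≡gy') (f∘g y' qy' (p∘g y' qy'))))
    where
    g-cong : ∀ {y y' qy qy'} → y ≡ y' → g y qy ≡ g y' qy'
    g-cong {qy = qy} {qy'} refl = cong (g _) (T-irrelevant qy qy')
    f-cong : ∀ {x x' px px'} → x ≡ x' → f x px ≡ f x' px'
    f-cong {px = px} {px'} refl = cong (f _) (T-irrelevant px px')

count-tabulate : ∀ {n} (p : B → Bool) (g : Fin n → B) → count p (List.tabulate g) ≡ count (p ∘ g) (allFin n)
count-tabulate p g = trans (cong (count p) (sym (map-tabulate (λ i → i) g))) (count-map p g (allFin _))

count-allFin-punchIn : ∀ {n} (i : Fin (suc n)) (p : Fin (suc n) → Bool) →
  count p (allFin (suc n)) ≡ (if p i then 1 else 0) + count (p ∘ punchIn i) (allFin n)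
count-allFin-punchIn {n} zero p =
  trans (count-∷ p zero _) (cong (_+_ (if p zero then 1 else 0)) (count-tabulate p (Fin.suc {n})))
count-allFin-punchIn {suc n} (suc i) p = begin
  count p (allFin (suc (suc n)))
    ≡⟨ trans (count-∷ p zero _) (cong (_+_ pz) (count-tabulate p (Fin.suc {suc n}))) ⟩
  pz + count (p ∘ suc) (allFin (suc n))
    ≡⟨ cong (_+_ pz) (count-allFin-punchIn i (p ∘ suc)) ⟩
  pz + (pi + count (p ∘ suc ∘ punchIn i) (allFin n))
    ≡⟨ x∙yz≈y∙xz pz pi _ ⟩
  pi + (pz + count (p ∘ suc ∘ punchIn i) (allFin n))
    ≡⟨ cong (_+_ pi) (sym (trans (count-∷ (p ∘ punchIn (suc i)) zero _)
                                  (cong (_+_ pz) (count-tabulate (p ∘ punchIn (suc i)) (Fin.suc {n}))))) ⟩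
  pi + count (p ∘ punchIn (suc i)) (allFin (suc n)) ∎
  where
  pz pi : ℕ
  pz = if p zero then 1 else 0
  pi = if p (suc i) then 1 else 0

count-toℕ-<ᵇ : ∀ n t → t ≤ n → count (λ (i : Fin n) → toℕ i <ᵇ t) (allFin n) ≡ t
count-toℕ-<ᵇ n       zero    _         = count-false (allFin n)
count-toℕ-<ᵇ (suc n) (suc t) (s≤s t≤n) =
  cong suc (trans (count-tabulate (λ (i : Fin (suc n)) → toℕ i <ᵇ suc t) (Fin.suc {n})) (count-toℕ-<ᵇ n t t≤n))

T-not⁺ : ∀ {a} → ¬ T a → T (not a)
T-not⁺ {false} _  = _
T-not⁺ {true}  ¬a = ¬a _

T-not⁻ : ∀ {a} → T (not a) → ¬ T a
T-not⁻ {false} _ ()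

T-⇒⁺ : ∀ {a b} → (T a → T b) → T (a ⇒ b)
T-⇒⁺ {false}         _   = _
T-⇒⁺ {true}  {true}  _   = _
T-⇒⁺ {true}  {false} a⇒b = a⇒b _

T-⇒⁻ : ∀ {a b} → T (a ⇒ b) → T a → T b
T-⇒⁻ {true} {true} _ _ = _

T-ext : ∀ {a b} → (T a → T b) → (T b → T a) → a ≡ b
T-ext {false} {false} _   _   = refl
T-ext {false} {true}  _   b⇒a = ⊥-elim (b⇒a _)
T-ext {true}  {false} a⇒b _   = ⊥-elim (a⇒b _)
T-ext {true}  {true}  _   _   = refl

T-∧³⁻ : ∀ {a b c} → T (a ∧ b ∧ c) → T a × T b × T c
T-∧³⁻ {a} t = let ta , tbc = to (T-∧ {a}) t in ta , to T-∧ tbc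

≟⁺ : ∀ {a b : ℕ} → a ≡ b → T ⌊ a ≟ b ⌋
≟⁺ = fromWitness

≟⁻ : ∀ {a b : ℕ} → T ⌊ a ≟ b ⌋ → a ≡ b
≟⁻ = toWitness

==F⁺ : ∀ {n} {i j : Fin n} → i ≡ j → T (i ==F j)
==F⁺ = fromWitness

==F⁻ : ∀ {n} {i j : Fin n} → T (i ==F j) → i ≡ j
==F⁻ = toWitness

∀F⁻ : ∀ {n} {p : Fin n → Bool} → T (∀F n p) → ∀ i → T (p i)
∀F⁻ {n} {p} t i = All.lookup (all⁺ p (allFin n) t) (∈-allFin i)

∀F⁺ : ∀ {n} {p : Fin n → Bool} → (∀ i → T (p i)) → T (∀F n p)
∀F⁺ {n} {p} h = all⁻ p (All.tabulate {xs = allFin n} λ {i} _ → h i)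

∃F⁻ : ∀ {n} {p : Fin n → Bool} → T (∃F n p) → ∃ λ i → T (p i)
∃F⁻ {n} {p} t = satisfied (any⁻ p (allFin n) t)

∃F⁺ : ∀ {n} {p : Fin n → Bool} (i : Fin n) → T (p i) → T (∃F n p)
∃F⁺ {n} {p} i pi = any⁺ p (lose (∈-allFin i) pi)

<F⁻ : ∀ {n} {i j : Fin n} → T (i <F j) → toℕ i < toℕ j
<F⁻ {i = i} {j} = <ᵇ⇒< (toℕ i) (toℕ j)

allVecs≡cartesianProduct : (n : ℕ) (xs : List A) →
  allVecs (suc n) xs ≡ cartesianProductWith _∷_ xs (allVecs n xs)
allVecs≡cartesianProduct n xs = go xs
  where
  go : ∀ ys → concatMap (λ y → map (y ∷_) (allVecs n xs)) ys ≡ cartesianProductWith _∷_ ys (allVecs n xs)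
  go []       = refl
  go (y ∷ ys) = cong (map (y ∷_) (allVecs n xs) ++_) (go ys)

allVecs-unique : (n : ℕ) {xs : List A} → Unique xs → Unique (allVecs n xs)
allVecs-unique zero    _   = [] ∷ []
allVecs-unique (suc n) {xs} xs! = subst Unique (sym (allVecs≡cartesianProduct n xs))
  (cartesianProductWith⁺ _∷_ ∷-injective xs! (allVecs-unique n xs!))

∈-allVecs : (n : ℕ) {xs : List A} → (∀ x → x ∈ xs) → (v : Vec A n) → v ∈ allVecs n xs
∈-allVecs zero    _     []      = here refl
∈-allVecs (suc n) {xs} all∈ (x ∷ v) = subst (x ∷ v ∈_) (sym (allVecs≡cartesianProduct n xs))
  (∈-cartesianProductWith⁺ _∷_ (all∈ x) (∈-allVecs n all∈ v))

allRels-unique : ∀ n → Unique (allRels n)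
allRels-unique n = allVecs-unique n (allVecs-unique n (((λ ()) ∷ []) ∷ [] ∷ []))

∈-allRels : ∀ n (R : Rel n) → R ∈ allRels n
∈-allRels n = ∈-allVecs n (∈-allVecs n λ { true → here refl ; false → there (here refl) })

lookup-ext : ∀ {n} {u v : Vec A n} → (∀ i → lookup u i ≡ lookup v i) → u ≡ v
lookup-ext {u = u} {v} u≗v = trans (sym (tabulate∘lookup u)) (trans (tabulate-cong u≗v) (tabulate∘lookup v))

tabulateRel : ∀ {n} → (Fin n → Fin n → Bool) → Rel n
tabulateRel r = tabulate λ i → tabulate (r i)

lookup-tabulateRel : ∀ {n} (r : Fin n → Fin n → Bool) i j → i ~[ tabulateRel r ] j ≡ r i j
lookup-tabulateRel r i j = trans (cong (λ row → lookup row j) (lookup∘tabulate (tabulate ∘ r) i)) (lookup∘tabulate (r i) j)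

Rel-ext : ∀ {n} {R S : Rel n} → (∀ i j → i ~[ R ] j ≡ i ~[ S ] j) → R ≡ S
Rel-ext R≗S = lookup-ext λ i → lookup-ext (R≗S i)

toℕ-punchIn-< : ∀ {n} (i : Fin (suc n)) (j : Fin n) → toℕ j < toℕ i → toℕ (punchIn i j) ≡ toℕ j
toℕ-punchIn-< (suc i) zero    _         = refl
toℕ-punchIn-< (suc i) (suc j) (s≤s j<i) = cong suc (toℕ-punchIn-< i j j<i)

toℕ-punchIn-≥ : ∀ {n} (i : Fin (suc n)) (j : Fin n) → toℕ i ≤ toℕ j → toℕ (punchIn i j) ≡ suc (toℕ j)
toℕ-punchIn-≥ zero    j       _         = refl
toℕ-punchIn-≥ (suc i) (suc j) (s≤s i≤j) = cong suc (toℕ-punchIn-≥ i j i≤j)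

punchIn-mono-< : ∀ {n} (i : Fin (suc n)) (a b : Fin n) → toℕ a < toℕ b → toℕ (punchIn i a) < toℕ (punchIn i b)
punchIn-mono-< zero    a       b       a<b       = s≤s a<b
punchIn-mono-< (suc i) zero    (suc b) _         = s≤s z≤n
punchIn-mono-< (suc i) (suc a) (suc b) (s≤s a<b) = s≤s (punchIn-mono-< i a b a<b)

punchIn-cancel-< : ∀ {n} (i : Fin (suc n)) (a b : Fin n) → toℕ (punchIn i a) < toℕ (punchIn i b) → toℕ a < toℕ b
punchIn-cancel-< zero    a       b       (s≤s a<b) = a<b
punchIn-cancel-< (suc i) zero    (suc b) _         = s≤s z≤n
punchIn-cancel-< (suc i) (suc a) (suc b) (s≤s a<b) = s≤s (punchIn-cancel-< i a b a<b)
punchIn-cancel-< (suc i) _       zero    ()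

punchIn-<-pivot⁻ : ∀ {n} (i : Fin (suc n)) (a : Fin n) → toℕ (punchIn i a) < toℕ i → toℕ a < toℕ i
punchIn-<-pivot⁻ i a a'<i with toℕ a <? toℕ i
... | yes a<i = a<i
... | no  a≮i = ⊥-elim (<-irrefl refl (<-trans a'<i
  (subst (toℕ i <_) (sym (toℕ-punchIn-≥ i a (≮⇒≥ a≮i))) (s≤s (≮⇒≥ a≮i)))))

<F-punchIn : ∀ {n} (i : Fin (suc n)) (a b : Fin n) → (punchIn i a <F punchIn i b) ≡ (a <F b)
<F-punchIn i a b = T-ext (<⇒<ᵇ ∘ punchIn-cancel-< i a b ∘ <F⁻) (<⇒<ᵇ ∘ punchIn-mono-< i a b ∘ <F⁻)

data PunchView {n} (i : Fin (suc n)) : Fin (suc n) → Set where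
  pivot   : PunchView i i
  punched : (a : Fin n) → PunchView i (punchIn i a)

punchView : ∀ {n} (i x : Fin (suc n)) → PunchView i x
punchView i x with i Fin.≟ x
... | yes refl = pivot
... | no  i≢x  = subst (PunchView i) (punchIn-punchOut i≢x) (punched (punchOut i≢x))

unpunch : ∀ {n} (i x : Fin (suc n)) → Maybe (Fin n)
unpunch i x with i Fin.≟ x
... | yes _   = nothing
... | no  i≢x = just (punchOut i≢x)

unpunch-pivot : ∀ {n} (i : Fin (suc n)) → unpunch i i ≡ nothing
unpunch-pivot i with i Fin.≟ i
... | yes _   = refl
... | no  i≢i = ⊥-elim (i≢i refl)

unpunch-punchIn : ∀ {n} (i : Fin (suc n)) (a : Fin n) → unpunch i (punchIn i a) ≡ just a
unpunch-punchIn i a with i Fin.≟ punchIn i a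
... | yes i≡a' = ⊥-elim (punchInᵢ≢i i a (sym i≡a'))
... | no  _    = cong just (trans (punchOut-cong i refl) (punchOut-punchIn i))

Least : ∀ {n} → (Fin n → Bool) → Fin n → Set
Least p i = T (p i) × (∀ j → toℕ j < toℕ i → ¬ T (p j))

least : ∀ {n} (p : Fin n → Bool) → ∃ (T ∘ p) → ∃ (Least p)
least {suc n} p (i , pi) with p zero in p0
... | true  = zero , subst T (sym p0) _ , λ _ ()
... | false with i
...   | zero  = ⊥-elim (subst T p0 pi)
...   | suc i' with least (p ∘ suc) (i' , pi)
...     | l , pl , l-least = suc l , pl , λ
            { zero    _         → subst T p0
            ; (suc j) (s≤s j<l) → l-least j j<l }

Least-unique : ∀ {n} {p : Fin n → Bool} {i j : Fin n} → Least p i → Least p j → i ≡ j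
Least-unique {i = i} {j} (pi , i-least) (pj , j-least) with <-cmp (toℕ i) (toℕ j)
... | tri< i<j _ _ = ⊥-elim (j-least i i<j pi)
... | tri≈ _ i≡j _ = toℕ-injective i≡j
... | tri> _ _ j<i = ⊥-elim (i-least j j<i pj)

-- Partitions, heads and front crossings

SameBlock : ∀ {n} → Rel n → Fin n → Fin n → Set
SameBlock R i j = T (i ~[ R ] j)

record IsPartition {n} (R : Rel n) : Set where
  field
    reflexive  : ∀ i → SameBlock R i i
    symmetric  : ∀ i j → SameBlock R i j → SameBlock R j i
    transitive : ∀ i j l → SameBlock R i j → SameBlock R j l → SameBlock R i l

IsHead : ∀ {n} → Rel n → Fin n → Set
IsHead R h = ∀ i → toℕ i < toℕ h → ¬ SameBlock R i h

record FrontCrossing (k : ℕ) {n} (R : Rel n) : Set where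
  constructor crossing
  field
    i₁ i₂ j₁ j₂  : Fin n
    i₁<i₂        : toℕ i₁ < toℕ i₂
    i₂<j₁        : toℕ i₂ < toℕ j₁
    j₁<j₂        : toℕ j₁ < toℕ j₂
    i₁∼j₁        : SameBlock R i₁ j₁
    i₂∼j₂        : SameBlock R i₂ j₂
    head-i₁      : IsHead R i₁
    head-i₂      : IsHead R i₂
    enough-heads : k ∸ 2 ≤ headsBetween n R i₂ j₁

HeadsBelow : ∀ {n} → ℕ → Rel n → Set
HeadsBelow m R = ∀ i → toℕ i < m → IsHead R i

record HeadedPartition (k m : ℕ) {n} (R : Rel n) : Set where
  field
    partition   : IsPartition R
    noncrossing : ¬ FrontCrossing k R
    heads       : HeadsBelow m R

isHeadedPartition : (k m n : ℕ) → Rel n → Bool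
isHeadedPartition k m n R =
  isPartition n R ∧ isKFrontNoncrossing k n R ∧ ∀F n (λ i → (toℕ i <ᵇ m) ⇒ isHead n R i)

isHead⁻ : ∀ {n} {R : Rel n} {h} → T (isHead n R h) → IsHead R h
isHead⁻ t i i<h = T-not⁻ (T-⇒⁻ (∀F⁻ t i) (<⇒<ᵇ i<h))

isHead⁺ : ∀ {n} {R : Rel n} {h} → IsHead R h → T (isHead n R h)
isHead⁺ {h = h} head = ∀F⁺ λ i → T-⇒⁺ λ i<h → T-not⁺ (head i (<ᵇ⇒< (toℕ i) (toℕ h) i<h))

isPartition⁻ : ∀ {n} {R : Rel n} → T (isPartition n R) → IsPartition R
isPartition⁻ t = let r , s , tr = T-∧³⁻ t in record
  { reflexive  = ∀F⁻ r
  ; symmetric  = λ i j → T-⇒⁻ (∀F⁻ (∀F⁻ s i) j)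
  ; transitive = λ i j l i∼j j∼l → T-⇒⁻ (∀F⁻ (∀F⁻ (∀F⁻ tr i) j) l) (from T-∧ (i∼j , j∼l))
  }

isPartition⁺ : ∀ {n} {R : Rel n} → IsPartition R → T (isPartition n R)
isPartition⁺ P = from T-∧ (∀F⁺ reflexive , from T-∧
  ( ∀F⁺ (λ i → ∀F⁺ λ j → T-⇒⁺ (symmetric i j))
  , ∀F⁺ (λ i → ∀F⁺ λ j → ∀F⁺ λ l → T-⇒⁺ λ t → let i∼j , j∼l = to T-∧ t in transitive i j l i∼j j∼l)))
  where open IsPartition P

isFrontEdge⁻ : ∀ {n} {R : Rel n} {i j} → T (isFrontEdge n R i j) → toℕ i < toℕ j × SameBlock R i j × IsHead R i
isFrontEdge⁻ {R = R} {i} {j} t = let i<j , i∼j , head = T-∧³⁻ {i <F j} t in <F⁻ i<j , i∼j , isHead⁻ {R = R} head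

hasFrontCrossing⁻ : ∀ {k n} {R : Rel n} → T (hasFrontCrossing k n R) → FrontCrossing k R
hasFrontCrossing⁻ {k} {n} {R} t =
  let i₁ , t₁ = ∃F⁻ t ; i₂ , t₂ = ∃F⁻ t₁ ; j₁ , t₃ = ∃F⁻ t₂ ; j₂ , t₄ = ∃F⁻ t₃
      i₁<i₂ , i₂<j₁ , t₅  = T-∧³⁻ {i₁ <F i₂} t₄
      j₁<j₂ , e₁ , t₆     = T-∧³⁻ {j₁ <F j₂} t₅
      e₂ , bound          = to (T-∧ {isFrontEdge n R i₂ j₂}) t₆
      _ , i₁∼j₁ , head-i₁ = isFrontEdge⁻ {R = R} e₁
      _ , i₂∼j₂ , head-i₂ = isFrontEdge⁻ {R = R} e₂
  in record
    { i₁ = i₁ ; i₂ = i₂ ; j₁ = j₁ ; j₂ = j₂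
    ; i₁<i₂ = <F⁻ i₁<i₂ ; i₂<j₁ = <F⁻ i₂<j₁ ; j₁<j₂ = <F⁻ j₁<j₂
    ; i₁∼j₁ = i₁∼j₁ ; i₂∼j₂ = i₂∼j₂ ; head-i₁ = head-i₁ ; head-i₂ = head-i₂
    ; enough-heads = ≤ᵇ⇒≤ _ _ bound
    }

hasFrontCrossing⁺ : ∀ {k n} {R : Rel n} → FrontCrossing k R → T (hasFrontCrossing k n R)
hasFrontCrossing⁺ {k} {n} {R} c = ∃F⁺ i₁ (∃F⁺ i₂ (∃F⁺ j₁ (∃F⁺ j₂
  (from T-∧ (<⇒<ᵇ i₁<i₂ , from T-∧ (<⇒<ᵇ i₂<j₁ , from T-∧ (<⇒<ᵇ j₁<j₂ ,
   from T-∧ (frontEdge (<-trans i₁<i₂ i₂<j₁) i₁∼j₁ head-i₁ ,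
   from T-∧ (frontEdge (<-trans i₂<j₁ j₁<j₂) i₂∼j₂ head-i₂ ,
   ≤⇒≤ᵇ enough-heads)))))))))
  where
  open FrontCrossing c
  frontEdge : ∀ {i j} → toℕ i < toℕ j → SameBlock R i j → IsHead R i → T (isFrontEdge n R i j)
  frontEdge i<j i∼j head = from T-∧ (<⇒<ᵇ i<j , from T-∧ (i∼j , isHead⁺ {R = R} head))

isHeadedPartition⁻ : ∀ {k m n} {R : Rel n} → T (isHeadedPartition k m n R) → HeadedPartition k m R
isHeadedPartition⁻ {m = m} {R = R} t = let P , nc , hs = T-∧³⁻ t in record
  { partition   = isPartition⁻ P
  ; noncrossing = T-not⁻ nc ∘ hasFrontCrossing⁺
  ; heads       = λ i i<m → isHead⁻ {R = R} (T-⇒⁻ (∀F⁻ hs i) (<⇒<ᵇ i<m))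
  }

isHeadedPartition⁺ : ∀ {k m n} {R : Rel n} → HeadedPartition k m R → T (isHeadedPartition k m n R)
isHeadedPartition⁺ {m = m} {R = R} H = from T-∧ (isPartition⁺ partition , from T-∧
  ( T-not⁺ (noncrossing ∘ hasFrontCrossing⁻)
  , ∀F⁺ λ i → T-⇒⁺ λ i<m → isHead⁺ {R = R} (heads i (<ᵇ⇒< (toℕ i) m i<m))))
  where open HeadedPartition H

headsBetween-< : ∀ {n} (R : Rel n) {a b : Fin n} → toℕ a < toℕ b → headsBetween n R a b < toℕ b
headsBetween-< {n} R {a} {b} a<b = ≤-<-trans
  (subst (headsBetween n R a b ≤_) (trans (count-true (upTo (toℕ b ∸ 1))) (length-upTo _))
    (count-≤-injection {p = between} (λ h _ → toℕ h ∸ 1) {q = λ _ → true} (allFin⁺ n)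
      (λ h bh → ∈-upTo⁺ (∸-monoˡ-< (h<b h bh) (positive h bh)))
      (λ _ _ → _)
      (λ h h' bh bh' eq → toℕ-injective (∸-cancelʳ-≡ (positive h bh) (positive h' bh') eq))))
  (pred-< (≤-<-trans z≤n a<b))
  where
  between : Fin n → Bool
  between h = (a <F h) ∧ (h <F b) ∧ isHead n R h
  positive : ∀ h → T (between h) → 1 ≤ toℕ h
  positive h bh = ≤-trans (s≤s z≤n) (<F⁻ {i = a} {h} (proj₁ (T-∧³⁻ {a <F h} {h <F b} bh)))
  h<b : ∀ h → T (between h) → toℕ h < toℕ b
  h<b h bh = <F⁻ {i = h} {b} (proj₁ (proj₂ (T-∧³⁻ {a <F h} {h <F b} bh)))
  pred-< : ∀ {t} → 0 < t → t ∸ 1 < t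
  pred-< {suc t} _ = ≤-refl

-- Adding a non-head point to a block

pullback : ∀ {m n} → (Fin m → Fin n) → Rel n → Rel m
pullback φ R = tabulateRel λ i j → φ i ~[ R ] φ j

lookup-pullback : ∀ {m n} (φ : Fin m → Fin n) (R : Rel n) i j → i ~[ pullback φ R ] j ≡ φ i ~[ R ] φ j
lookup-pullback φ R = lookup-tabulateRel λ i j → φ i ~[ R ] φ j

pullback-isPartition : ∀ {m n} (φ : Fin m → Fin n) {R : Rel n} → IsPartition R → IsPartition (pullback φ R)
pullback-isPartition φ {R} P = record
  { reflexive  = λ i → into i i (reflexive (φ i))
  ; symmetric  = λ i j i∼j → into j i (symmetric _ _ (outof i j i∼j))
  ; transitive = λ i j l i∼j j∼l → into i l (transitive _ _ _ (outof i j i∼j) (outof j l j∼l))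
  }
  where
  open IsPartition P
  outof : ∀ i j → SameBlock (pullback φ R) i j → SameBlock R (φ i) (φ j)
  outof i j = subst T (lookup-pullback φ R i j)
  into : ∀ i j → SameBlock R (φ i) (φ j) → SameBlock (pullback φ R) i j
  into i j = subst T (sym (lookup-pullback φ R i j))

module _ {n} (M : Fin (suc n)) where

  collapse : Fin n → Fin (suc n) → Fin n
  collapse c x = fromMaybe c (unpunch M x)

  collapse-pivot : ∀ c → collapse c M ≡ c
  collapse-pivot c = cong (fromMaybe c) (unpunch-pivot M)

  collapse-punchIn : ∀ c a → collapse c (punchIn M a) ≡ a
  collapse-punchIn c a = cong (fromMaybe c) (unpunch-punchIn M a)

  punchIn-collapse : ∀ d {y} → y ≢ M → punchIn M (collapse d y) ≡ y
  punchIn-collapse d {y} y≢M with punchView M y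
  ... | pivot     = ⊥-elim (y≢M refl)
  ... | punched a = cong (punchIn M) (collapse-punchIn d a)

  record PivotJoins (R : Rel (suc n)) (R' : Rel n) (c : Fin n) : Set where
    field
      partition : IsPartition R
      restricts : ∀ i j → (punchIn M i ~[ R ] punchIn M j) ≡ (i ~[ R' ] j)
      joins     : SameBlock R (punchIn M c) M
      c<M       : toℕ c < toℕ M

    open IsPartition partition

    lower : ∀ {i j} → SameBlock R (punchIn M i) (punchIn M j) → SameBlock R' i j
    lower = subst T (restricts _ _)

    raise : ∀ {i j} → SameBlock R' i j → SameBlock R (punchIn M i) (punchIn M j)
    raise = subst T (sym (restricts _ _))

    punchIn-c<M : toℕ (punchIn M c) < toℕ M
    punchIn-c<M = subst (_< toℕ M) (sym (toℕ-punchIn-< M c c<M)) c<M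

    pivot-not-head : ¬ IsHead R M
    pivot-not-head head = head (punchIn M c) punchIn-c<M joins

    head-lower : ∀ {x} → IsHead R (punchIn M x) → IsHead R' x
    head-lower {x} head j j<x j∼x = head (punchIn M j) (punchIn-mono-< M j x j<x) (raise j∼x)

    head-raise : ∀ {x} → IsHead R' x → IsHead R (punchIn M x)
    head-raise {x} head y y<x y∼x with punchView M y
    ... | pivot     = head c (punchIn-cancel-< M c x (<-trans punchIn-c<M y<x))
                        (lower (transitive _ _ _ joins y∼x))
    ... | punched j = head j (punchIn-cancel-< M j x y<x) (lower y∼x)

    heads-lower : HeadsBelow (toℕ M) R → HeadsBelow (toℕ M) R'
    heads-lower heads a a<M = head-lower (heads (punchIn M a) (subst (_< toℕ M) (sym (toℕ-punchIn-< M a a<M)) a<M))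

    heads-raise : HeadsBelow (toℕ M) R' → HeadsBelow (toℕ M) R
    heads-raise heads x x<M with punchView M x
    ... | pivot     = ⊥-elim (<-irrefl refl x<M)
    ... | punched a = head-raise (heads a (punchIn-<-pivot⁻ M a x<M))

    isHead-punchIn : ∀ x → isHead (suc n) R (punchIn M x) ≡ isHead n R' x
    isHead-punchIn x = T-ext (isHead⁺ {R = R'} ∘ head-lower ∘ isHead⁻ {R = R})
                             (isHead⁺ {R = R} ∘ head-raise ∘ isHead⁻ {R = R'})

    headsBetween-punchIn : ∀ a b → headsBetween (suc n) R (punchIn M a) (punchIn M b) ≡ headsBetween n R' a b
    headsBetween-punchIn a b = begin
      count between (allFin (suc n))
        ≡⟨ count-allFin-punchIn M between ⟩
      (if between M then 1 else 0) + count (between ∘ punchIn M) (allFin n)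
        ≡⟨ cong (λ b → (if b then 1 else 0) + count (between ∘ punchIn M) (allFin n)) between-pivot ⟩
      count (between ∘ punchIn M) (allFin n)
        ≡⟨ count-cong (λ x → cong₂ _∧_ (<F-punchIn M a x) (cong₂ _∧_ (<F-punchIn M x b) (isHead-punchIn x))) (allFin n) ⟩
      count (λ h → (a <F h) ∧ (h <F b) ∧ isHead n R' h) (allFin n) ∎
      where
      between : Fin (suc n) → Bool
      between h = (punchIn M a <F h) ∧ (h <F punchIn M b) ∧ isHead (suc n) R h
      between-pivot : between M ≡ false
      between-pivot = T-ext (λ t → pivot-not-head (isHead⁻ {R = R}
        (proj₂ (proj₂ (T-∧³⁻ {punchIn M a <F M} {M <F punchIn M b} t))))) λ ()

    crossing-raise : ∀ {k} → FrontCrossing k R' → FrontCrossing k R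
    crossing-raise (crossing i₁ i₂ j₁ j₂ i₁<i₂ i₂<j₁ j₁<j₂ i₁∼j₁ i₂∼j₂ head-i₁ head-i₂ enough-heads) =
      crossing (punchIn M i₁) (punchIn M i₂) (punchIn M j₁) (punchIn M j₂)
        (punchIn-mono-< M _ _ i₁<i₂) (punchIn-mono-< M _ _ i₂<j₁) (punchIn-mono-< M _ _ j₁<j₂)
        (raise i₁∼j₁) (raise i₂∼j₂) (head-raise head-i₁) (head-raise head-i₂)
        (subst (_ ≤_) (sym (headsBetween-punchIn i₂ j₁)) enough-heads)

    noncrossing-raise : ∀ {k} → HeadsBelow (toℕ M) R → toℕ M ≤ k ∸ 2 →
      ¬ FrontCrossing k R' → ¬ FrontCrossing k R
    noncrossing-raise {k} heads M≤k noncrossing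
      (crossing i₁ i₂ j₁ j₂ i₁<i₂ i₂<j₁ j₁<j₂ i₁∼j₁ i₂∼j₂ head-i₁ head-i₂ enough-heads)
      with punchView M j₂ | punchView M j₁ | punchView M i₁ | punchView M i₂
    ... | pivot | _ | _ | _ = heads j₁ j₁<j₂ i₁ (<-trans i₁<i₂ i₂<j₁) i₁∼j₁
    ... | _ | pivot | _ | _ =
      <-irrefl refl (≤-<-trans enough-heads (<-≤-trans (headsBetween-< R i₂<j₁) M≤k))
    ... | _ | _ | pivot | _ = pivot-not-head head-i₁
    ... | _ | _ | _ | pivot = pivot-not-head head-i₂
    ... | punched b₂ | punched b₁ | punched a₁ | punched a₂ = noncrossing
      (crossing a₁ a₂ b₁ b₂
        (punchIn-cancel-< M _ _ i₁<i₂) (punchIn-cancel-< M _ _ i₂<j₁) (punchIn-cancel-< M _ _ j₁<j₂)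
        (lower i₁∼j₁) (lower i₂∼j₂) (head-lower head-i₁) (head-lower head-i₂)
        (subst (_ ≤_) (headsBetween-punchIn a₂ b₁) enough-heads))

module _ {n} (M : Fin (suc n)) where

  deletePivot : Rel (suc n) → Rel n
  deletePivot = pullback (punchIn M)

  joinPivot : Fin n → Rel n → Rel (suc n)
  joinPivot c = pullback (collapse M c)

  deletePivot-joins : ∀ {R c} → IsPartition R → SameBlock R (punchIn M c) M → toℕ c < toℕ M →
    PivotJoins M R (deletePivot R) c
  deletePivot-joins {R} P c∼M c<M = record
    { partition = P ; restricts = λ i j → sym (lookup-pullback (punchIn M) R i j) ; joins = c∼M ; c<M = c<M }

  lookup-joinPivot : ∀ c R' i j → punchIn M i ~[ joinPivot c R' ] punchIn M j ≡ i ~[ R' ] j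
  lookup-joinPivot c R' i j = trans (lookup-pullback (collapse M c) R' _ _)
    (cong₂ (λ a b → a ~[ R' ] b) (collapse-punchIn M c i) (collapse-punchIn M c j))

  joinPivot-joins : ∀ {R' c} → IsPartition R' → toℕ c < toℕ M → PivotJoins M (joinPivot c R') R' c
  joinPivot-joins {R'} {c} P' c<M = record
    { partition = pullback-isPartition (collapse M c) P'
    ; restricts = lookup-joinPivot c R'
    ; joins     = subst T (sym (trans (lookup-pullback (collapse M c) R' _ _)
                    (cong₂ (λ a b → a ~[ R' ] b) (collapse-punchIn M c c) (collapse-pivot M c))))
                    (IsPartition.reflexive P' c)
    ; c<M       = c<M
    }

  deletePivot-joinPivot : ∀ c R' → deletePivot (joinPivot c R') ≡ R'
  deletePivot-joinPivot c R' = Rel-ext λ i j →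
    trans (lookup-pullback (punchIn M) (joinPivot c R') i j) (lookup-joinPivot c R' i j)

  joinPivot-deletePivot : ∀ {R c} → IsPartition R → SameBlock R (punchIn M c) M → joinPivot c (deletePivot R) ≡ R
  joinPivot-deletePivot {R} {c} P c∼M = Rel-ext λ x y → trans (lookup-pullback (collapse M c) (deletePivot R) x y)
    (trans (lookup-pullback (punchIn M) R _ _) (T-ext
      (λ x'∼y' → transitive _ _ _ (symmetric _ _ (collapse∼ x)) (transitive _ _ _ x'∼y' (collapse∼ y)))
      (λ x∼y → transitive _ _ _ (collapse∼ x) (transitive _ _ _ x∼y (symmetric _ _ (collapse∼ y))))))
    where
    open IsPartition P
    collapse∼ : ∀ x → SameBlock R (punchIn M (collapse M c x)) x
    collapse∼ x with punchView M x
    ... | pivot     = subst (λ a → SameBlock R (punchIn M a) M) (sym (collapse-pivot M c)) c∼M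
    ... | punched a = subst (λ a' → SameBlock R (punchIn M a') (punchIn M a)) (sym (collapse-punchIn M c a)) (reflexive _)

  pivot-joins-below : ∀ {R} → ¬ IsHead R M → ∃ λ j → SameBlock R (punchIn M j) M × toℕ j < toℕ M
  pivot-joins-below {R} not-head with any? (λ j → T? (punchIn M j ~[ R ] M) ×-dec (toℕ j <? toℕ M))
  ... | yes found   = found
  ... | no  missing = ⊥-elim (not-head λ x x<M x∼M → below x x<M x∼M (punchView M x))
    where
    below : ∀ x → toℕ x < toℕ M → SameBlock R x M → PunchView M x → ⊥
    below x x<M _   pivot       = <-irrefl refl x<M
    below x x<M x∼M (punched a) = missing (a , x∼M , punchIn-<-pivot⁻ M a x<M)

-- The recurrence for h

module _ {k n} (M : Fin (suc n)) (M≤k : toℕ M ≤ k ∸ 2) where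

  private
    m : ℕ
    m = toℕ M

  pivotNotHead : Rel (suc n) → Bool
  pivotNotHead R = isHeadedPartition k m (suc n) R ∧ not (isHead (suc n) R M)

  belowAndHeaded : Fin n × Rel n → Bool
  belowAndHeaded cR' = (toℕ (proj₁ cR') <ᵇ m) ∧ isHeadedPartition k m n (proj₂ cR')

  private
    module Delete (R : Rel (suc n)) (pR : T (pivotNotHead R)) where
      H : HeadedPartition k m R
      H = isHeadedPartition⁻ (proj₁ (to T-∧ pR))
      open HeadedPartition H

      not-head : ¬ IsHead R M
      not-head = T-not⁻ (proj₂ (to (T-∧ {isHeadedPartition k m (suc n) R}) pR)) ∘ isHead⁺ {R = R}

      joinsPivot : Fin n → Bool
      joinsPivot j = punchIn M j ~[ R ] M

      least-joining : ∃ (Least joinsPivot)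
      least-joining = let j , j∼M , _ = pivot-joins-below M {R} not-head in least joinsPivot (j , j∼M)

      c : Fin n
      c = proj₁ least-joining

      c<M : toℕ c < m
      c<M = let j , j∼M , j<M = pivot-joins-below M {R} not-head in
        ≤-<-trans (≮⇒≥ λ j<c → proj₂ (proj₂ least-joining) j j<c j∼M) j<M

      joins : PivotJoins M R (deletePivot M R) c
      joins = deletePivot-joins M partition (proj₁ (proj₂ least-joining)) c<M

      headed : HeadedPartition k m (deletePivot M R)
      headed = record
        { partition   = pullback-isPartition (punchIn M) partition
        ; noncrossing = noncrossing ∘ PivotJoins.crossing-raise joins
        ; heads       = PivotJoins.heads-lower joins heads
        }

    module Join (c : Fin n) (R' : Rel n) (q : T (belowAndHeaded (c , R'))) where
      c<M : toℕ c < m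
      c<M = <ᵇ⇒< (toℕ c) m (proj₁ (to T-∧ q))

      H' : HeadedPartition k m R'
      H' = isHeadedPartition⁻ (proj₂ (to (T-∧ {toℕ c <ᵇ m}) q))
      open HeadedPartition H'

      joins : PivotJoins M (joinPivot M c R') R' c
      joins = joinPivot-joins M partition c<M
      open PivotJoins joins using (heads-raise; noncrossing-raise)

      headed : HeadedPartition k m (joinPivot M c R')
      headed = record
        { partition   = PivotJoins.partition joins
        ; noncrossing = noncrossing-raise (heads-raise heads) M≤k noncrossing
        ; heads       = heads-raise heads
        }

      c-least : Least (λ j → punchIn M j ~[ joinPivot M c R' ] M) c
      c-least = PivotJoins.joins joins , λ j j<c j∼M →
        heads c c<M j j<c (PivotJoins.lower joins {j} {c}
          (transitive (punchIn M j) M (punchIn M c) j∼M (symmetric (punchIn M c) M (PivotJoins.joins joins))))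
        where open IsPartition (PivotJoins.partition joins)

  count-pivot-not-head : count pivotNotHead (allRels (suc n)) ≡ m *ℕ h k m n
  count-pivot-not-head = begin
    count pivotNotHead (allRels (suc n))
      ≡⟨ count-≡-by-inverses forward backward forward-ok backward-ok backward∘forward forward∘backward
           (allRels-unique (suc n)) (cartesianProduct⁺ (allFin⁺ n) (allRels-unique n))
           (∈-allRels (suc n)) (λ (c , R') → ∈-cartesianProduct⁺ (∈-allFin c) (∈-allRels n R')) ⟩
    count belowAndHeaded (cartesianProduct (allFin n) (allRels n))
      ≡⟨ count-cartesianProduct (λ c → toℕ c <ᵇ m) (isHeadedPartition k m n) (allFin n) (allRels n) ⟩
    count (λ c → toℕ c <ᵇ m) (allFin n) *ℕ h k m n
      ≡⟨ cong (_*ℕ h k m n) (count-toℕ-<ᵇ n m (≤-pred (toℕ<n M))) ⟩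
    m *ℕ h k m n ∎
    where
    forward : ∀ R → T (pivotNotHead R) → Fin n × Rel n
    forward R pR = Delete.c R pR , deletePivot M R
    backward : ∀ cR' → T (belowAndHeaded cR') → Rel (suc n)
    backward (c , R') _ = joinPivot M c R'
    forward-ok : ∀ R pR → T (belowAndHeaded (forward R pR))
    forward-ok R pR = from T-∧ (<⇒<ᵇ (Delete.c<M R pR) , isHeadedPartition⁺ (Delete.headed R pR))
    backward-ok : ∀ cR' q → T (pivotNotHead (backward cR' q))
    backward-ok (c , R') q = from T-∧ (isHeadedPartition⁺ (Join.headed c R' q) ,
      T-not⁺ (PivotJoins.pivot-not-head (Join.joins c R' q) ∘ isHead⁻ {R = joinPivot M c R'}))
    backward∘forward : ∀ R pR q → backward (forward R pR) q ≡ R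
    backward∘forward R pR _ =
      joinPivot-deletePivot M (PivotJoins.partition (Delete.joins R pR)) (PivotJoins.joins (Delete.joins R pR))
    forward∘backward : ∀ cR' q pR → forward (backward cR' q) pR ≡ cR'
    forward∘backward (c , R') q pR = cong₂ _,_
      (Least-unique (proj₂ (Delete.least-joining (joinPivot M c R') pR)) (Join.c-least c R' q))
      (deletePivot-joinPivot M c R')

  private
    headed-suc : ∀ R → isHeadedPartition k (suc m) (suc n) R ≡ isHeadedPartition k m (suc n) R ∧ isHead (suc n) R M
    headed-suc R = T-ext
      (λ t → let H = isHeadedPartition⁻ {k} {suc m} {R = R} t in
        from T-∧ (isHeadedPartition⁺ (record { HeadedPartition H
                                             ; heads = λ i i<m → HeadedPartition.heads H i (m≤n⇒m≤1+n i<m) })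
                 , isHead⁺ {R = R} (HeadedPartition.heads H M ≤-refl)))
      (λ t → let hp , head-M = to (T-∧ {isHeadedPartition k m (suc n) R}) t ; H = isHeadedPartition⁻ {k} {m} {R = R} hp in
        isHeadedPartition⁺ (record { HeadedPartition H ; heads = heads-suc H (isHead⁻ {R = R} head-M) }))
      where
      heads-suc : HeadedPartition k m R → IsHead R M → HeadsBelow (suc m) R
      heads-suc H head-M i i<1+m with m≤n⇒m<n∨m≡n (≤-pred i<1+m)
      ... | inj₁ i<m = HeadedPartition.heads H i i<m
      ... | inj₂ i≡m = subst (IsHead R) (toℕ-injective (sym i≡m)) head-M

  h-split : h k m (suc n) ≡ h k (suc m) (suc n) + m *ℕ h k m n
  h-split = trans (count-∧-split (isHeadedPartition k m (suc n)) (λ R → isHead (suc n) R M) (allRels (suc n)))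
    (cong₂ _+_ (sym (count-cong headed-suc (allRels (suc n)))) count-pivot-not-head)

Perm : ℕ → Set
Perm n = Vec (Fin n) n

record IsPermutation {m} (σ : Perm m) : Set where
  constructor permutation
  field injective : Injective _≡_ _≡_ (lookup σ)

module _ {m} {σ : Perm m} where

  private
    entry : Fin m → Fin m → Bool
    entry i j = (lookup σ i ==F lookup σ j) ⇒ (i ==F j)

  isPerm⁻ : T (isPerm m σ) → IsPermutation σ
  isPerm⁻ t = permutation λ {i} {j} σi≡σj →
    ==F⁻ (T-⇒⁻ {lookup σ i ==F lookup σ j} (∀F⁻ {p = entry i} (∀F⁻ {p = λ i → ∀F m (entry i)} t i) j) (==F⁺ σi≡σj))

  isPerm⁺ : IsPermutation σ → T (isPerm m σ)
  isPerm⁺ (permutation σ!) = ∀F⁺ {p = λ i → ∀F m (entry i)} λ i → ∀F⁺ {p = entry i} λ j →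
    T-⇒⁺ {lookup σ i ==F lookup σ j} {i ==F j} λ t → ==F⁺ (σ! (==F⁻ t))

iter-+ : ∀ {m} (σ : Perm m) a b x → iter σ (a + b) x ≡ iter σ a (iter σ b x)
iter-+ σ zero    b x = refl
iter-+ σ (suc a) b x = cong (lookup σ) (iter-+ σ a b x)

iter-injective : ∀ {m} {σ : Perm m} → IsPermutation σ → ∀ t {x y} → iter σ t x ≡ iter σ t y → x ≡ y
iter-injective σ! zero    eq = eq
iter-injective σ! (suc t) eq = iter-injective σ! t (IsPermutation.injective σ! eq)

iter-period : ∀ {m} {σ : Perm m} → IsPermutation σ → (x : Fin m) →
  ∃ λ p → 0 < p × p ≤ m × iter σ p x ≡ x
iter-period {m} {σ} σ! x with pigeonhole (n<1+n m) (λ (t : Fin (suc m)) → iter σ (toℕ t) x)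
... | a , b , a<b , same = toℕ b ∸ toℕ a , m<n⇒0<n∸m a<b , ≤-trans (m∸n≤m (toℕ b) (toℕ a)) (≤-pred (toℕ<n b)) ,
  iter-injective σ! (toℕ a)
    (trans (sym (iter-+ σ (toℕ a) _ x)) (trans (cong (λ t → iter σ t x) (m+[n∸m]≡n (<⇒≤ a<b))) (sym same)))

iter-multiple : ∀ {m} (σ : Perm m) {p x} → iter σ p x ≡ x → ∀ q → iter σ (q *ℕ p) x ≡ x
iter-multiple σ         fixed zero    = refl
iter-multiple σ {p} {x} fixed (suc q) = trans (iter-+ σ p (q *ℕ p) x) (trans (cong (iter σ p) (iter-multiple σ fixed q)) fixed)

iter-reduce : ∀ {m} {σ : Perm m} → IsPermutation σ → ∀ x t → ∃ λ t' → t' < m × iter σ t x ≡ iter σ t' x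
iter-reduce {m} {σ} σ! x t with iter-period σ! x
... | suc p , _ , p≤m , fixed = t % suc p , <-≤-trans (m%n<n t (suc p)) p≤m , (begin
  iter σ t x                                         ≡⟨ cong (λ s → iter σ s x) (m≡m%n+[m/n]*n t (suc p)) ⟩
  iter σ (t % suc p + t / suc p *ℕ suc p) x           ≡⟨ iter-+ σ (t % suc p) _ x ⟩
  iter σ (t % suc p) (iter σ (t / suc p *ℕ suc p) x)  ≡⟨ cong (iter σ (t % suc p)) (iter-multiple σ fixed (t / suc p)) ⟩
  iter σ (t % suc p) x                                ∎)

CycleMin : ∀ {m} → Perm m → Fin m → Set
CycleMin σ i = ∀ t → toℕ i ≤ toℕ (iter σ t i)

-- isCycleMin only inspects the first m iterates, which cover the whole orbit of a permutation.
isCycleMin⁻ : ∀ {m} {σ : Perm m} {i} → IsPermutation σ → T (isCycleMin m σ i) → CycleMin σ i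
isCycleMin⁻ {m} {σ} {i} σ! t s with iter-reduce σ! i s
... | s' , s'<m , same = subst (λ y → toℕ i ≤ toℕ y) (sym same)
  (≤ᵇ⇒≤ (toℕ i) _ (All.lookup (all⁺ (λ t → toℕ i ≤ᵇ toℕ (iter σ t i)) (upTo m) t) (∈-upTo⁺ s'<m)))

isCycleMin⁺ : ∀ {m} {σ : Perm m} {i} → CycleMin σ i → T (isCycleMin m σ i)
isCycleMin⁺ {m} {σ} {i} min =
  all⁻ (λ t → toℕ i ≤ᵇ toℕ (iter σ t i)) (All.tabulate {xs = upTo m} λ {s} _ → ≤⇒≤ᵇ (min s))

-- Inserting the last point into a permutation

module LastPoint (m : ℕ) where

  last : Fin (suc m)
  last = fromℕ m

  ι : Fin m → Fin (suc m)
  ι = punchIn last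

  toℕ-ι : ∀ j → toℕ (ι j) ≡ toℕ j
  toℕ-ι j = toℕ-punchIn-< last j (subst (toℕ j <_) (sym (toℕ-fromℕ m)) (toℕ<n j))

  ι<last : ∀ j → toℕ (ι j) < toℕ last
  ι<last j = subst (toℕ (ι j) <_) (sym (toℕ-fromℕ m)) (subst (_< m) (sym (toℕ-ι j)) (toℕ<n j))

  ι≢last : ∀ j → ι j ≢ last
  ι≢last = punchInᵢ≢i last

  ι-injective : ∀ {i j} → ι i ≡ ι j → i ≡ j
  ι-injective = punchIn-injective last _ _

  record FixesLast (σ : Perm (suc m)) (σ' : Perm m) : Set where
    field
      fixes  : lookup σ last ≡ last
      agrees : ∀ j → lookup σ (ι j) ≡ ι (lookup σ' j)

  record InsertsLastAfter (c : Fin m) (σ : Perm (suc m)) (σ' : Perm m) : Set where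
    field
      enters : lookup σ (ι c) ≡ last
      leaves : lookup σ last ≡ ι (lookup σ' c)
      agrees : ∀ j → j ≢ c → lookup σ (ι j) ≡ ι (lookup σ' j)

  nextSkippingLast : Perm (suc m) → Fin (suc m) → Fin (suc m)
  nextSkippingLast σ y = if lookup σ y ==F last then lookup σ last else lookup σ y

  skipLast : Perm (suc m) → Perm m
  skipLast σ = tabulate λ j → collapse last j (nextSkippingLast σ (ι j))

  fixLastAt : Perm m → Fin (suc m) → Fin (suc m)
  fixLastAt σ' = maybe (ι ∘ lookup σ') last ∘ unpunch last

  fixLast : Perm m → Perm (suc m)
  fixLast σ' = tabulate (fixLastAt σ')

  insertLastAfterAt : Fin m → Perm m → Fin (suc m) → Fin (suc m)
  insertLastAfterAt c σ' = maybe (λ j → if j ==F c then last else ι (lookup σ' j)) (ι (lookup σ' c)) ∘ unpunch last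

  insertLastAfter : Fin m → Perm m → Perm (suc m)
  insertLastAfter c σ' = tabulate (insertLastAfterAt c σ')

  private
    if-==F-≡ : ∀ {n} {i j : Fin n} {A : Set} {a b : A} → i ≡ j → (if i ==F j then a else b) ≡ a
    if-==F-≡ {i = i} {j} i≡j with i Fin.≟ j
    ... | yes _   = refl
    ... | no  i≢j = ⊥-elim (i≢j i≡j)

    if-==F-≢ : ∀ {n} {i j : Fin n} {A : Set} {a b : A} → i ≢ j → (if i ==F j then a else b) ≡ b
    if-==F-≢ {i = i} {j} i≢j with i Fin.≟ j
    ... | yes i≡j = ⊥-elim (i≢j i≡j)
    ... | no  _   = refl

  module _ {σ : Perm (suc m)} (σ! : IsPermutation σ) where

    private
      σ-injective : Injective _≡_ _≡_ (lookup σ)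
      σ-injective = IsPermutation.injective σ!

      ι-skipLast : ∀ j → lookup σ (ι j) ≢ last → ι (lookup (skipLast σ) j) ≡ lookup σ (ι j)
      ι-skipLast j σj≢last = trans (cong ι (lookup∘tabulate _ j))
        (trans (cong (ι ∘ collapse last j) (if-==F-≢ σj≢last)) (punchIn-collapse last j σj≢last))

    skipLast-fixes : lookup σ last ≡ last → FixesLast σ (skipLast σ)
    skipLast-fixes fixed = record
      { fixes  = fixed
      ; agrees = λ j → sym (ι-skipLast j λ σj≡last → ι≢last j (σ-injective (trans σj≡last (sym fixed))))
      }

    skipLast-inserts : ∀ {c} → lookup σ (ι c) ≡ last → InsertsLastAfter c σ (skipLast σ)
    skipLast-inserts {c} enters = record
      { enters = enters
      ; leaves = sym (trans (cong ι (lookup∘tabulate _ c))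
          (trans (cong (ι ∘ collapse last c) (if-==F-≡ enters)) (punchIn-collapse last c λ σlast≡last →
            ι≢last c (σ-injective (trans enters (sym σlast≡last))))))
      ; agrees = λ j j≢c → sym (ι-skipLast j λ σj≡last → j≢c (ι-injective (σ-injective (trans σj≡last (sym enters)))))
      }

  fixLast-fixes : ∀ σ' → FixesLast (fixLast σ') σ'
  fixLast-fixes σ' = record
    { fixes  = trans (lookup∘tabulate (fixLastAt σ') last) (cong (maybe (ι ∘ lookup σ') last) (unpunch-pivot last))
    ; agrees = λ j → trans (lookup∘tabulate (fixLastAt σ') (ι j)) (cong (maybe (ι ∘ lookup σ') last) (unpunch-punchIn last j))
    }

  insertLastAfter-inserts : ∀ c σ' → InsertsLastAfter c (insertLastAfter c σ') σ'
  insertLastAfter-inserts c σ' = record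
    { enters = trans (at-ι c) (if-==F-≡ {i = c} refl)
    ; leaves = trans (lookup∘tabulate (insertLastAfterAt c σ') last) (cong after (unpunch-pivot last))
    ; agrees = λ j j≢c → trans (at-ι j) (if-==F-≢ j≢c)
    }
    where
    after : Maybe (Fin m) → Fin (suc m)
    after = maybe (λ j → if j ==F c then last else ι (lookup σ' j)) (ι (lookup σ' c))
    at-ι : ∀ j → lookup (insertLastAfter c σ') (ι j) ≡ (if j ==F c then last else ι (lookup σ' j))
    at-ι j = trans (lookup∘tabulate (insertLastAfterAt c σ') (ι j)) (cong after (unpunch-punchIn last j))

  FixesLast-unique-left : ∀ {σ₁ σ₂ σ'} → FixesLast σ₁ σ' → FixesLast σ₂ σ' → σ₁ ≡ σ₂
  FixesLast-unique-left {σ₁} {σ₂} F₁ F₂ = lookup-ext λ x → at x (punchView last x)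
    where
    at : ∀ x → PunchView last x → lookup σ₁ x ≡ lookup σ₂ x
    at _ pivot       = trans (FixesLast.fixes F₁) (sym (FixesLast.fixes F₂))
    at _ (punched j) = trans (FixesLast.agrees F₁ j) (sym (FixesLast.agrees F₂ j))

  FixesLast-unique-right : ∀ {σ σ₁' σ₂'} → FixesLast σ σ₁' → FixesLast σ σ₂' → σ₁' ≡ σ₂'
  FixesLast-unique-right F₁ F₂ = lookup-ext λ j → ι-injective (trans (sym (FixesLast.agrees F₁ j)) (FixesLast.agrees F₂ j))

  FixesLast-permutation : ∀ {σ σ'} → FixesLast σ σ' → IsPermutation σ' → IsPermutation σ
  FixesLast-permutation {σ} {σ'} F σ'! = permutation λ {x} {y} → at x y (punchView last x) (punchView last y)
    where
    open FixesLast F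
    at : ∀ x y → PunchView last x → PunchView last y → lookup σ x ≡ lookup σ y → x ≡ y
    at _ _ pivot       pivot       _  = refl
    at _ _ pivot       (punched j) eq = ⊥-elim (ι≢last (lookup σ' j) (sym (trans (sym fixes) (trans eq (agrees j)))))
    at _ _ (punched i) pivot       eq = ⊥-elim (ι≢last (lookup σ' i) (trans (sym (agrees i)) (trans eq fixes)))
    at _ _ (punched i) (punched j) eq =
      cong ι (IsPermutation.injective σ'! (ι-injective (trans (sym (agrees i)) (trans eq (agrees j)))))

  FixesLast-permutation⁻ : ∀ {σ σ'} → FixesLast σ σ' → IsPermutation σ → IsPermutation σ'
  FixesLast-permutation⁻ F σ! = permutation λ {i} {j} eq →
    ι-injective (IsPermutation.injective σ! (trans (FixesLast.agrees F i) (trans (cong ι eq) (sym (FixesLast.agrees F j)))))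

  InsertsLastAfter-unique-left : ∀ {c σ₁ σ₂ σ'} →
    InsertsLastAfter c σ₁ σ' → InsertsLastAfter c σ₂ σ' → σ₁ ≡ σ₂
  InsertsLastAfter-unique-left {c} {σ₁} {σ₂} I₁ I₂ = lookup-ext λ x → at x (punchView last x)
    where
    open InsertsLastAfter
    at : ∀ x → PunchView last x → lookup σ₁ x ≡ lookup σ₂ x
    at _ pivot = trans (leaves I₁) (sym (leaves I₂))
    at _ (punched j) with j Fin.≟ c
    ... | yes refl = trans (enters I₁) (sym (enters I₂))
    ... | no  j≢c  = trans (agrees I₁ j j≢c) (sym (agrees I₂ j j≢c))

  InsertsLastAfter-unique-right : ∀ {c σ σ₁' σ₂'} →
    InsertsLastAfter c σ σ₁' → InsertsLastAfter c σ σ₂' → σ₁' ≡ σ₂'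
  InsertsLastAfter-unique-right {c} {σ₁' = σ₁'} {σ₂'} I₁ I₂ = lookup-ext λ j → ι-injective (at j)
    where
    open InsertsLastAfter
    at : ∀ j → ι (lookup σ₁' j) ≡ ι (lookup σ₂' j)
    at j with j Fin.≟ c
    ... | yes refl = trans (sym (leaves I₁)) (leaves I₂)
    ... | no  j≢c  = trans (sym (agrees I₁ j j≢c)) (agrees I₂ j j≢c)

  InsertsLastAfter-unique-point : ∀ {c₁ c₂ σ σ₁' σ₂'} → IsPermutation σ →
    InsertsLastAfter c₁ σ σ₁' → InsertsLastAfter c₂ σ σ₂' → c₁ ≡ c₂
  InsertsLastAfter-unique-point σ! I₁ I₂ =
    ι-injective (IsPermutation.injective σ! (trans (InsertsLastAfter.enters I₁) (sym (InsertsLastAfter.enters I₂))))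

  module _ {c σ σ'} (I : InsertsLastAfter c σ σ') where
    open InsertsLastAfter I

    InsertsLastAfter-permutation⁻ : IsPermutation σ → IsPermutation σ'
    InsertsLastAfter-permutation⁻ σ! = permutation λ {i} {j} eq → at i j (i Fin.≟ c) (j Fin.≟ c) eq
      where
      σ-injective : Injective _≡_ _≡_ (lookup σ)
      σ-injective = IsPermutation.injective σ!
      at : ∀ i j → Dec (i ≡ c) → Dec (j ≡ c) → lookup σ' i ≡ lookup σ' j → i ≡ j
      at i j (yes i≡c) (yes j≡c) _  = trans i≡c (sym j≡c)
      at i j (yes refl) (no j≢c) eq =
        ⊥-elim (ι≢last j (sym (σ-injective (trans leaves (trans (cong ι eq) (sym (agrees j j≢c)))))))
      at i j (no i≢c) (yes refl) eq =
        ⊥-elim (ι≢last i (σ-injective (trans (agrees i i≢c) (trans (cong ι eq) (sym leaves)))))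
      at i j (no i≢c) (no j≢c)   eq =
        ι-injective (σ-injective (trans (agrees i i≢c) (trans (cong ι eq) (sym (agrees j j≢c)))))

    InsertsLastAfter-permutation : IsPermutation σ' → IsPermutation σ
    InsertsLastAfter-permutation σ'! = permutation λ {x} {y} → at x y (punchView last x) (punchView last y)
      where
      σ'-injective : Injective _≡_ _≡_ (lookup σ')
      σ'-injective = IsPermutation.injective σ'!
      not-last : ∀ j → j ≢ c → lookup σ (ι j) ≢ last
      not-last j j≢c σj≡last = ι≢last (lookup σ' j) (trans (sym (agrees j j≢c)) σj≡last)
      at : ∀ x y → PunchView last x → PunchView last y → lookup σ x ≡ lookup σ y → x ≡ y
      at _ _ pivot pivot _ = refl
      at _ _ pivot (punched j) eq with j Fin.≟ c
      ... | yes refl = ⊥-elim (ι≢last (lookup σ' c) (trans (sym leaves) (trans eq enters)))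
      ... | no  j≢c  = ⊥-elim (j≢c (sym (σ'-injective (ι-injective (trans (sym leaves) (trans eq (agrees j j≢c)))))))
      at _ _ (punched i) pivot eq with i Fin.≟ c
      ... | yes refl = ⊥-elim (ι≢last (lookup σ' c) (trans (sym leaves) (trans (sym eq) enters)))
      ... | no  i≢c  = ⊥-elim (i≢c (σ'-injective (ι-injective (trans (sym (agrees i i≢c)) (trans eq leaves)))))
      at _ _ (punched i) (punched j) eq with i Fin.≟ c | j Fin.≟ c
      ... | yes refl | yes refl = refl
      ... | yes refl | no  j≢c  = ⊥-elim (not-last j j≢c (trans (sym eq) enters))
      ... | no  i≢c  | yes refl = ⊥-elim (not-last i i≢c (trans eq enters))
      ... | no  i≢c  | no  j≢c  =
        cong ι (σ'-injective (ι-injective (trans (sym (agrees i i≢c)) (trans eq (agrees j j≢c)))))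

  isCycleMin-ι : ∀ {σ σ'} → IsPermutation σ → IsPermutation σ' → ∀ j →
    (∀ t → (∃ λ s → iter σ t (ι j) ≡ ι (iter σ' s j)) ⊎ iter σ t (ι j) ≡ last) →
    (∀ s → ∃ λ t → ι (iter σ' s j) ≡ iter σ t (ι j)) →
    isCycleMin (suc m) σ (ι j) ≡ isCycleMin m σ' j
  isCycleMin-ι {σ} {σ'} σ! σ'! j down up = T-ext
    (λ t → isCycleMin⁺ λ s → let t' , eq = up s in
      subst₂ _≤_ (toℕ-ι j) (trans (cong toℕ (sym eq)) (toℕ-ι _)) (isCycleMin⁻ σ! t t'))
    (λ t → isCycleMin⁺ λ u → [ (λ (s , eq) → subst₂ _≤_ (sym (toℕ-ι j)) (trans (sym (toℕ-ι _)) (cong toℕ (sym eq)))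
                                                        (isCycleMin⁻ σ'! t s))
                             , (λ eq → subst (toℕ (ι j) ≤_) (cong toℕ (sym eq)) (<⇒≤ (ι<last j))) ]′ (down u))

  cycles-ι : ∀ {σ σ'} → (∀ j → isCycleMin (suc m) σ (ι j) ≡ isCycleMin m σ' j) →
    cycles (suc m) σ ≡ (if isCycleMin (suc m) σ last then 1 else 0) + cycles m σ'
  cycles-ι {σ} {σ'} same = trans (count-allFin-punchIn last (isCycleMin (suc m) σ))
    (cong (_+_ _) (count-cong same (allFin m)))

  FixesLast-cycles : ∀ {σ σ'} → FixesLast σ σ' → IsPermutation σ' → cycles (suc m) σ ≡ suc (cycles m σ')
  FixesLast-cycles {σ} {σ'} F σ'! =
    trans (cycles-ι λ j → isCycleMin-ι σ! σ'! j (λ t → inj₁ (t , iter-ι t j)) (λ s → s , sym (iter-ι s j)))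
          (cong (λ b → (if b then 1 else 0) + cycles m σ') last-is-min)
    where
    open FixesLast F
    σ! : IsPermutation σ
    σ! = FixesLast-permutation F σ'!
    iter-ι : ∀ t j → iter σ t (ι j) ≡ ι (iter σ' t j)
    iter-ι zero    j = refl
    iter-ι (suc t) j = trans (cong (lookup σ) (iter-ι t j)) (agrees _)
    iter-last : ∀ t → iter σ t last ≡ last
    iter-last zero    = refl
    iter-last (suc t) = trans (cong (lookup σ) (iter-last t)) fixes
    last-is-min : isCycleMin (suc m) σ last ≡ true
    last-is-min = T-ext _ λ _ → isCycleMin⁺ λ t → subst (λ y → toℕ last ≤ toℕ y) (sym (iter-last t)) ≤-refl

  InsertsLastAfter-cycles : ∀ {c σ σ'} → InsertsLastAfter c σ σ' → IsPermutation σ' → cycles (suc m) σ ≡ cycles m σ'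
  InsertsLastAfter-cycles {c} {σ} {σ'} I σ'! =
    trans (cycles-ι λ j → isCycleMin-ι σ! σ'! j (down j) (up j))
          (cong (λ b → (if b then 1 else 0) + cycles m σ') last-not-min)
    where
    open InsertsLastAfter I
    σ! : IsPermutation σ
    σ! = InsertsLastAfter-permutation I σ'!
    trace : ∀ j t → ∃ λ s → iter σ t (ι j) ≡ ι (iter σ' s j) ⊎ (iter σ t (ι j) ≡ last × iter σ' s j ≡ c)
    trace j zero = 0 , inj₁ refl
    trace j (suc t) with trace j t
    ... | s , inj₂ (at-last , ≡c) =
      suc s , inj₁ (trans (cong (lookup σ) at-last) (trans leaves (cong (ι ∘ lookup σ') (sym ≡c))))
    ... | s , inj₁ eq with iter σ' s j Fin.≟ c
    ...   | yes ≡c = s , inj₂ (trans (cong (lookup σ) eq) (trans (cong (lookup σ ∘ ι) ≡c) enters) , ≡c)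
    ...   | no  ≢c = suc s , inj₁ (trans (cong (lookup σ) eq) (agrees _ ≢c))
    down : ∀ j t → (∃ λ s → iter σ t (ι j) ≡ ι (iter σ' s j)) ⊎ iter σ t (ι j) ≡ last
    down j t with trace j t
    ... | s , inj₁ eq            = inj₁ (s , eq)
    ... | _ , inj₂ (at-last , _) = inj₂ at-last
    up : ∀ j s → ∃ λ t → ι (iter σ' s j) ≡ iter σ t (ι j)
    up j zero = 0 , refl
    up j (suc s) with up j s | iter σ' s j Fin.≟ c
    ... | t , eq | yes ≡c = suc (suc t) , (begin
      ι (lookup σ' (iter σ' s j))        ≡⟨ cong (ι ∘ lookup σ') ≡c ⟩
      ι (lookup σ' c)                     ≡⟨ sym leaves ⟩
      lookup σ last                       ≡⟨ cong (lookup σ) (sym enters) ⟩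
      lookup σ (lookup σ (ι c))           ≡⟨ cong (lookup σ ∘ lookup σ ∘ ι) (sym ≡c) ⟩
      lookup σ (lookup σ (ι (iter σ' s j))) ≡⟨ cong (lookup σ ∘ lookup σ) eq ⟩
      iter σ (suc (suc t)) (ι j)          ∎)
    ... | t , eq | no  ≢c = suc t , trans (sym (agrees _ ≢c)) (cong (lookup σ) eq)
    last-not-min : isCycleMin (suc m) σ last ≡ false
    last-not-min = T-ext (λ t → <-irrefl refl (≤-<-trans (isCycleMin⁻ σ! t 1)
      (subst (_< toℕ last) (cong toℕ (sym leaves)) (ι<last _)))) λ ()

  last-preimage : ∀ {σ} → IsPermutation σ → lookup σ last ≢ last → ∃ λ c → lookup σ (ι c) ≡ last
  last-preimage {σ} σ! moves with iter-period σ! last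
  ... | suc p , _ , _ , back = at (iter σ p last) (punchView last (iter σ p last)) back
    where
    at : ∀ y → PunchView last y → lookup σ y ≡ last → ∃ λ c → lookup σ (ι c) ≡ last
    at _ pivot       fixed = ⊥-elim (moves fixed)
    at _ (punched c) enters = c , enters

-- The recurrence for the Stirling numbers of the first kind

hasCycles : (m r : ℕ) → Perm m → Bool
hasCycles m r σ = isPerm m σ ∧ ⌊ cycles m σ ≟ r ⌋

allPerms : (m : ℕ) → List (Perm m)
allPerms m = allVecs m (allFin m)

allPerms-unique : ∀ m → Unique (allPerms m)
allPerms-unique m = allVecs-unique m (allFin⁺ m)

∈-allPerms : ∀ m σ → σ ∈ allPerms m
∈-allPerms m = ∈-allVecs m ∈-allFin

module _ (m r : ℕ) where
  open LastPoint m

  hasCyclesFixingLast : Perm (suc m) → Bool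
  hasCyclesFixingLast σ = hasCycles (suc m) r σ ∧ (lookup σ last ==F last)

  hasCyclesMovingLast : Perm (suc m) → Bool
  hasCyclesMovingLast σ = hasCycles (suc m) r σ ∧ not (lookup σ last ==F last)

  hasOneFewerCycles : Perm m → Bool
  hasOneFewerCycles σ' = isPerm m σ' ∧ ⌊ suc (cycles m σ') ≟ r ⌋

  private
    hasCycles⁻ : ∀ {n} {σ : Perm n} → T (hasCycles n r σ) → IsPermutation σ × cycles n σ ≡ r
    hasCycles⁻ {n} {σ} t = let perm , cyc = to (T-∧ {isPerm n σ}) t in isPerm⁻ {σ = σ} perm , ≟⁻ cyc

    hasCycles⁺ : ∀ {n} {σ : Perm n} → IsPermutation σ → cycles n σ ≡ r → T (hasCycles n r σ)
    hasCycles⁺ σ! cyc = from T-∧ (isPerm⁺ σ! , ≟⁺ cyc)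

    fixing⁻ : ∀ {σ} → T (hasCyclesFixingLast σ) → IsPermutation σ × cycles (suc m) σ ≡ r × lookup σ last ≡ last
    fixing⁻ {σ} t = let hc , fixed = to (T-∧ {hasCycles (suc m) r σ}) t ; σ! , cyc = hasCycles⁻ {σ = σ} hc in
      σ! , cyc , ==F⁻ fixed

    moving⁻ : ∀ {σ} → T (hasCyclesMovingLast σ) → IsPermutation σ × cycles (suc m) σ ≡ r × lookup σ last ≢ last
    moving⁻ {σ} t = let hc , moves = to (T-∧ {hasCycles (suc m) r σ}) t ; σ! , cyc = hasCycles⁻ {σ = σ} hc in
      σ! , cyc , λ fixed → T-not⁻ moves (==F⁺ fixed)

  count-fixing : count hasCyclesFixingLast (allPerms (suc m)) ≡ count hasOneFewerCycles (allPerms m)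
  count-fixing = count-≡-by-inverses (λ σ _ → skipLast σ) (λ σ' _ → fixLast σ')
    (λ σ p → let σ! , cyc , fixed = fixing⁻ {σ} p ; F = skipLast-fixes σ! fixed ; σ'! = FixesLast-permutation⁻ F σ! in
      from T-∧ (isPerm⁺ σ'! , ≟⁺ (trans (sym (FixesLast-cycles F σ'!)) cyc)))
    (λ σ' q → let perm , cyc = to (T-∧ {isPerm m σ'}) q ; σ'! = isPerm⁻ {σ = σ'} perm ; F = fixLast-fixes σ' in
      from T-∧ (hasCycles⁺ (FixesLast-permutation F σ'!) (trans (FixesLast-cycles F σ'!) (≟⁻ cyc)) ,
                ==F⁺ (FixesLast.fixes F)))
    (λ σ p _ → let σ! , _ , fixed = fixing⁻ {σ} p in
      FixesLast-unique-left (fixLast-fixes (skipLast σ)) (skipLast-fixes σ! fixed))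
    (λ σ' _ p → let σ! , _ , fixed = fixing⁻ {fixLast σ'} p in
      FixesLast-unique-right (skipLast-fixes σ! fixed) (fixLast-fixes σ'))
    (allPerms-unique (suc m)) (allPerms-unique m) (∈-allPerms (suc m)) (∈-allPerms m)

  count-moving : count hasCyclesMovingLast (allPerms (suc m)) ≡ m *ℕ permsWithCycles m r
  count-moving = begin
    count hasCyclesMovingLast (allPerms (suc m))
      ≡⟨ count-≡-by-inverses forward backward forward-ok backward-ok backward∘forward forward∘backward
           (allPerms-unique (suc m)) (cartesianProduct⁺ (allFin⁺ m) (allPerms-unique m))
           (∈-allPerms (suc m)) (λ (c , σ') → ∈-cartesianProduct⁺ (∈-allFin c) (∈-allPerms m σ')) ⟩
    count (λ cσ' → true ∧ hasCycles m r (proj₂ cσ')) (cartesianProduct (allFin m) (allPerms m))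
      ≡⟨ count-cartesianProduct (λ _ → true) (hasCycles m r) (allFin m) (allPerms m) ⟩
    count (λ _ → true) (allFin m) *ℕ permsWithCycles m r
      ≡⟨ cong (_*ℕ permsWithCycles m r) (trans (count-true (allFin m)) (length-tabulate {n = m} (λ i → i))) ⟩
    m *ℕ permsWithCycles m r ∎
    where
    forward : ∀ σ → T (hasCyclesMovingLast σ) → Fin m × Perm m
    forward σ p = let σ! , _ , moves = moving⁻ {σ} p in proj₁ (last-preimage σ! moves) , skipLast σ
    inserts : ∀ σ p → InsertsLastAfter (proj₁ (forward σ p)) σ (skipLast σ)
    inserts σ p = let σ! , _ , moves = moving⁻ {σ} p in skipLast-inserts σ! (proj₂ (last-preimage σ! moves))
    backward : ∀ cσ' → T (true ∧ hasCycles m r (proj₂ cσ')) → Perm (suc m)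
    backward (c , σ') _ = insertLastAfter c σ'
    forward-ok : ∀ σ p → T (true ∧ hasCycles m r (proj₂ (forward σ p)))
    forward-ok σ p = let σ! , cyc , _ = moving⁻ {σ} p ; I = inserts σ p ; σ'! = InsertsLastAfter-permutation⁻ I σ! in
      hasCycles⁺ σ'! (trans (sym (InsertsLastAfter-cycles I σ'!)) cyc)
    backward-ok : ∀ cσ' q → T (hasCyclesMovingLast (backward cσ' q))
    backward-ok (c , σ') q = let σ'! , cyc = hasCycles⁻ {σ = σ'} q ; I = insertLastAfter-inserts c σ' in
      from T-∧ (hasCycles⁺ (InsertsLastAfter-permutation I σ'!) (trans (InsertsLastAfter-cycles I σ'!) cyc) ,
                T-not⁺ λ t → ι≢last (lookup σ' c) (trans (sym (InsertsLastAfter.leaves I)) (==F⁻ t)))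
    backward∘forward : ∀ σ p q → backward (forward σ p) q ≡ σ
    backward∘forward σ p _ = InsertsLastAfter-unique-left (insertLastAfter-inserts _ (skipLast σ)) (inserts σ p)
    forward∘backward : ∀ cσ' q p → forward (backward cσ' q) p ≡ cσ'
    forward∘backward (c , σ') q p =
      let σ'! , _ = hasCycles⁻ {σ = σ'} q ; I = insertLastAfter-inserts c σ'
          σ! = InsertsLastAfter-permutation I σ'!
          c'≡c = InsertsLastAfter-unique-point σ! (inserts (insertLastAfter c σ') p) I
      in cong₂ _,_ c'≡c (InsertsLastAfter-unique-right (subst-point c'≡c (inserts (insertLastAfter c σ') p)) I)
      where
      subst-point : ∀ {c₁ c₂ σ σ'} → c₁ ≡ c₂ → InsertsLastAfter c₁ σ σ' → InsertsLastAfter c₂ σ σ'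
      subst-point refl I = I

permsWithCycles-split : ∀ m r →
  permsWithCycles (suc m) r ≡ count (hasOneFewerCycles m r) (allPerms m) + m *ℕ permsWithCycles m r
permsWithCycles-split m r = trans
  (count-∧-split (hasCycles (suc m) r) (λ σ → lookup σ last ==F last) (allPerms (suc m)))
  (cong₂ _+_ (count-fixing m r) (count-moving m r))
  where open LastPoint m

permsWithCycles-suc : ∀ m r → permsWithCycles (suc m) (suc r) ≡ permsWithCycles m r + m *ℕ permsWithCycles m (suc r)
permsWithCycles-suc m r = trans (permsWithCycles-split m (suc r))
  (cong (_+ m *ℕ permsWithCycles m (suc r)) (count-cong one-fewer (allPerms m)))
  where
  one-fewer : ∀ σ' → hasOneFewerCycles m (suc r) σ' ≡ hasCycles m r σ'
  one-fewer σ' = cong (isPerm m σ' ∧_) (T-ext (≟⁺ ∘ suc-injective ∘ ≟⁻) (≟⁺ ∘ cong suc ∘ ≟⁻))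

permsWithCycles-zero : ∀ m → permsWithCycles (suc m) 0 ≡ m *ℕ permsWithCycles m 0
permsWithCycles-zero m = trans (permsWithCycles-split m 0)
  (cong (_+ m *ℕ permsWithCycles m 0) (trans (count-cong (∧-zeroʳ ∘ isPerm m) (allPerms m)) (count-false (allPerms m))))

permsWithCycles-above : ∀ m r → m < r → permsWithCycles m r ≡ 0
permsWithCycles-above zero    (suc r) _         = refl
permsWithCycles-above (suc m) (suc r) (s≤s m<r) = begin
  permsWithCycles (suc m) (suc r)                       ≡⟨ permsWithCycles-suc m r ⟩
  permsWithCycles m r + m *ℕ permsWithCycles m (suc r) ≡⟨ cong₂ (λ a b → a + m *ℕ b) (permsWithCycles-above m r m<r)
                                                             (permsWithCycles-above m (suc r) (m<n⇒m<1+n m<r)) ⟩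
  m *ℕ 0                                                ≡⟨ *-zeroʳ m ⟩
  0                                                     ∎

permsWithCycles-no-cycles : ∀ m → permsWithCycles (suc m) 0 ≡ 0
permsWithCycles-no-cycles zero    = permsWithCycles-zero 0
permsWithCycles-no-cycles (suc m) =
  trans (permsWithCycles-zero (suc m)) (trans (cong (suc m *ℕ_) (permsWithCycles-no-cycles m)) (*-zeroʳ (suc m)))

sign-suc : ∀ e → sign (suc e) ≡ - sign e
sign-suc zero    = refl
sign-suc (suc e) = sym (trans (cong -_ (sign-suc e)) (ℤ.neg-involutive (sign e)))

s-above : ∀ m r → m < r → s m r ≡ + 0
s-above m r m<r = trans (cong (λ c → sign (m ∸ r) * + c) (permsWithCycles-above m r m<r)) (ℤ.*-zeroʳ (sign (m ∸ r)))

s-no-cycles : ∀ m → 1 ≤ m → s m 0 ≡ + 0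
s-no-cycles (suc m) _ = trans (cong (λ c → sign (suc m) * + c) (permsWithCycles-no-cycles m)) (ℤ.*-zeroʳ (sign (suc m)))

s-suc : ∀ m r → r ≤ m → s (suc m) (suc r) ≡ s m r - + m * s m (suc r)
s-suc m r r≤m = begin
  sign (m ∸ r) * + permsWithCycles (suc m) (suc r)
    ≡⟨ cong (λ c → sign (m ∸ r) * + c) (permsWithCycles-suc m r) ⟩
  sign (m ∸ r) * + (c₀ + m *ℕ c₁)
    ≡⟨ cong (sign (m ∸ r) *_) (trans (ℤ.pos-+ c₀ (m *ℕ c₁)) (cong (_+ℤ_ (+ c₀)) (ℤ.pos-* m c₁))) ⟩
  sign (m ∸ r) * (+ c₀ +ℤ + m * + c₁)
    ≡⟨ distribute (sign (m ∸ r)) (+ c₀) (+ m) (+ c₁) ⟩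
  s m r +ℤ + m * (sign (m ∸ r) * + c₁)
    ≡⟨ cong (λ z → s m r +ℤ + m * z) sign-flips ⟩
  s m r +ℤ + m * - s m (suc r)
    ≡⟨ negate (s m r) (+ m) (s m (suc r)) ⟩
  s m r - + m * s m (suc r) ∎
  where
  c₀ c₁ : ℕ
  c₀ = permsWithCycles m r
  c₁ = permsWithCycles m (suc r)
  distribute : ∀ (σ a x b : ℤ) → σ * (a +ℤ x * b) ≡ σ * a +ℤ x * (σ * b)
  distribute = solve-∀
  negate : ∀ (a x b : ℤ) → a +ℤ x * - b ≡ a - x * b
  negate = solve-∀
  sign-flips : sign (m ∸ r) * + c₁ ≡ - s m (suc r)
  sign-flips with m≤n⇒m<n∨m≡n r≤m
  ... | inj₁ r<m = begin
    sign (m ∸ r) * + c₁             ≡⟨ cong (λ e → sign e * + c₁) (+-∸-assoc 1 r<m) ⟩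
    sign (suc (m ∸ suc r)) * + c₁   ≡⟨ cong (_* + c₁) (sign-suc (m ∸ suc r)) ⟩
    - sign (m ∸ suc r) * + c₁       ≡⟨ ℤ.neg-distribˡ-* (sign (m ∸ suc r)) (+ c₁) ⟨
    - s m (suc r)                   ∎
  ... | inj₂ refl = begin
    sign (m ∸ m) * + c₁   ≡⟨ cong (λ c → sign (m ∸ m) * + c) (permsWithCycles-above m (suc m) (n<1+n m)) ⟩
    sign (m ∸ m) * + 0    ≡⟨ ℤ.*-zeroʳ (sign (m ∸ m)) ⟩
    + 0                   ≡⟨ cong -_ (s-above m (suc m) (n<1+n m)) ⟨
    - s m (suc m)         ∎

sum1to-cong : ∀ m {g g' : ℕ → ℤ} → (∀ r → 1 ≤ r → r ≤ m → g r ≡ g' r) → sum1to m g ≡ sum1to m g'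
sum1to-cong zero    _    = refl
sum1to-cong (suc m) g≗g' =
  cong₂ _+ℤ_ (sum1to-cong m λ r 1≤r r≤m → g≗g' r 1≤r (m≤n⇒m≤1+n r≤m)) (g≗g' (suc m) (s≤s z≤n) ≤-refl)

sum1to-+ : ∀ m (g g' : ℕ → ℤ) → sum1to m (λ r → g r +ℤ g' r) ≡ sum1to m g +ℤ sum1to m g'
sum1to-+ zero    g g' = refl
sum1to-+ (suc m) g g' = trans (cong (_+ℤ (g (suc m) +ℤ g' (suc m))) (sum1to-+ m g g'))
  (interchange (sum1to m g) (sum1to m g') (g (suc m)) (g' (suc m)))
  where
  interchange : ∀ (a b x y : ℤ) → a +ℤ b +ℤ (x +ℤ y) ≡ a +ℤ x +ℤ (b +ℤ y)
  interchange = solve-∀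

sum1to-*ˡ : ∀ m (x : ℤ) (g : ℕ → ℤ) → sum1to m (λ r → x * g r) ≡ x * sum1to m g
sum1to-*ˡ zero    x g = sym (ℤ.*-zeroʳ x)
sum1to-*ˡ (suc m) x g = trans (cong (_+ℤ x * g (suc m)) (sum1to-*ˡ m x g)) (sym (ℤ.*-distribˡ-+ x (sum1to m g) (g (suc m))))

sum1to-suc-shift : ∀ m (g : ℕ → ℤ) → sum1to (suc m) g ≡ g 1 +ℤ sum1to m (λ r → g (suc r))
sum1to-suc-shift zero    g = ℤ.+-comm (+ 0) (g 1)
sum1to-suc-shift (suc m) g = trans (cong (_+ℤ g (suc (suc m))) (sum1to-suc-shift m g)) (ℤ.+-assoc (g 1) _ _)

stirling-sum-suc : ∀ m → 1 ≤ m → (G : ℕ → ℤ) →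
  sum1to (suc m) (λ r → s (suc m) r * G r) ≡ sum1to m (λ r → s m r * G (suc r)) - + m * sum1to m (λ r → s m r * G r)
stirling-sum-suc m 1≤m G = begin
  sum1to (suc m) (λ r → s (suc m) r * G r)
    ≡⟨ sum1to-cong (suc m) pointwise ⟩
  sum1to (suc m) (λ r → s m (r ∸ 1) * G r +ℤ - + m * (s m r * G r))
    ≡⟨ sum1to-+ (suc m) _ _ ⟩
  sum1to (suc m) (λ r → s m (r ∸ 1) * G r) +ℤ sum1to (suc m) (λ r → - + m * (s m r * G r))
    ≡⟨ cong₂ _+ℤ_ (sum1to-suc-shift m _) (sum1to-*ˡ (suc m) (- + m) _) ⟩
  s m 0 * G 1 +ℤ shifted +ℤ - + m * (unshifted +ℤ s m (suc m) * G (suc m))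
    ≡⟨ cong₂ (λ a b → a * G 1 +ℤ shifted +ℤ - + m * (unshifted +ℤ b * G (suc m)))
             (s-no-cycles m 1≤m) (s-above m (suc m) (n<1+n m)) ⟩
  + 0 * G 1 +ℤ shifted +ℤ - + m * (unshifted +ℤ + 0 * G (suc m))
    ≡⟨ simplify shifted unshifted (+ m) (G 1) (G (suc m)) ⟩
  shifted - + m * unshifted ∎
  where
  shifted unshifted : ℤ
  shifted = sum1to m (λ r → s m r * G (suc r))
  unshifted = sum1to m (λ r → s m r * G r)
  pointwise : ∀ r → 1 ≤ r → r ≤ suc m → s (suc m) r * G r ≡ s m (r ∸ 1) * G r +ℤ - + m * (s m r * G r)
  pointwise (suc r) _ (s≤s r≤m) = trans (cong (_* G (suc r)) (s-suc m r r≤m)) (expand (s m r) (+ m) (s m (suc r)) (G (suc r)))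
    where
    expand : ∀ (a x b g : ℤ) → (a - x * b) * g ≡ a * g +ℤ - x * (b * g)
    expand = solve-∀
  simplify : ∀ (a b x g₁ g₂ : ℤ) → + 0 * g₁ +ℤ a +ℤ - x * (b +ℤ + 0 * g₂) ≡ a - x * b
  simplify = solve-∀

h-one : ∀ k n → h k 1 n ≡ f k n
h-one k n = count-cong (λ R → cong (isPartition n R ∧_)
  (trans (cong (isKFrontNoncrossing k n R ∧_) (only-head R)) (∧-identityʳ _))) (allRels n)
  where
  only-head : ∀ R → ∀F n (λ i → (toℕ i <ᵇ 1) ⇒ isHead n R i) ≡ true
  only-head R = T-ext _ λ _ → ∀F⁺ {p = λ i → (toℕ i <ᵇ 1) ⇒ isHead n R i} λ
    { zero    → isHead⁺ {R = R} {zero} (λ _ ())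
    ; (suc _) → _ }

h-suc : ∀ k m n → m ≤ n → m ≤ k ∸ 2 → + h k (suc m) (suc n) ≡ + h k m (suc n) - + m * + h k m n
h-suc k m n m≤n m≤k = begin
  + h k (suc m) (suc n)
    ≡⟨ move (+ h k (suc m) (suc n)) (+ m * + h k m n) ⟩
  + h k (suc m) (suc n) +ℤ + m * + h k m n - + m * + h k m n
    ≡⟨ cong (_- + m * + h k m n) (sym split-ℤ) ⟩
  + h k m (suc n) - + m * + h k m n ∎
  where
  M : Fin (suc n)
  M = fromℕ< (s≤s m≤n)
  split : h k m (suc n) ≡ h k (suc m) (suc n) + m *ℕ h k m n
  split = subst (λ t → h k t (suc n) ≡ h k (suc t) (suc n) + t *ℕ h k t n) (toℕ-fromℕ< (s≤s m≤n))
    (h-split {k} M (subst (_≤ k ∸ 2) (sym (toℕ-fromℕ< (s≤s m≤n))) m≤k))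
  split-ℤ : + h k m (suc n) ≡ + h k (suc m) (suc n) +ℤ + m * + h k m n
  split-ℤ = trans (cong +_ split) (trans (ℤ.pos-+ (h k (suc m) (suc n)) (m *ℕ h k m n))
    (cong (_+ℤ_ (+ h k (suc m) (suc n))) (ℤ.pos-* m (h k m n))))
  move : ∀ (a b : ℤ) → a ≡ a +ℤ b - b
  move = solve-∀

∸-pred : ∀ k {a} → suc a ≤ k ∸ 1 → a ≤ k ∸ 2
∸-pred (suc (suc k)) a<k = ≤-pred a<k

h≡stirling-sum : ∀ k m n → 1 ≤ m → m ≤ k ∸ 1 → m ≤ n →
  + h k m n ≡ sum1to m (λ r → s m r * + f k (n ∸ m + r))
h≡stirling-sum k 1 n _ _ 1≤n = begin
  + h k 1 n                        ≡⟨ cong +_ (h-one k n) ⟩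
  + f k n                          ≡⟨ cong (λ t → + f k t) (trans (sym (m+[n∸m]≡n 1≤n)) (+-comm 1 (n ∸ 1))) ⟩
  + f k (n ∸ 1 + 1)                ≡⟨ sym (trans (ℤ.+-identityˡ _) (ℤ.*-identityˡ _)) ⟩
  + 0 +ℤ s 1 1 * + f k (n ∸ 1 + 1) ∎
h≡stirling-sum k (suc (suc m)) (suc n) _ m+2≤k (s≤s m+1≤n) = begin
  + h k (suc (suc m)) (suc n)
    ≡⟨ h-suc k (suc m) n m+1≤n (∸-pred k m+2≤k) ⟩
  + h k (suc m) (suc n) - + suc m * + h k (suc m) n
    ≡⟨ cong₂ (λ a b → a - + suc m * b) (h≡stirling-sum k (suc m) (suc n) (s≤s z≤n) m+1≤k (m≤n⇒m≤1+n m+1≤n))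
                                         (h≡stirling-sum k (suc m) n (s≤s z≤n) m+1≤k m+1≤n) ⟩
  sum1to (suc m) (λ r → s (suc m) r * + f k (n ∸ m + r)) - + suc m * sum1to (suc m) (λ r → s (suc m) r * G r)
    ≡⟨ cong (_- + suc m * sum1to (suc m) (λ r → s (suc m) r * G r))
         (sum1to-cong (suc m) λ r _ _ → cong (λ t → s (suc m) r * + f k t) (shift r)) ⟩
  sum1to (suc m) (λ r → s (suc m) r * G (suc r)) - + suc m * sum1to (suc m) (λ r → s (suc m) r * G r)
    ≡⟨ stirling-sum-suc (suc m) (s≤s z≤n) G ⟨
  sum1to (suc (suc m)) (λ r → s (suc (suc m)) r * G r) ∎
  where
  G : ℕ → ℤ
  G r = + f k (n ∸ suc m + r)
  m+1≤k : suc m ≤ k ∸ 1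
  m+1≤k = ≤-trans (n≤1+n (suc m)) m+2≤k
  shift : ∀ r → n ∸ m + r ≡ n ∸ suc m + suc r
  shift r = trans (cong (_+ r) (+-∸-assoc 1 m+1≤n)) (sym (+-suc (n ∸ suc m) r))

corollary2p4 : (k m n : ℕ) → 2 ≤ k → 1 ≤ m → m ≤ k ∸ 1 → m ≤ n →
    + h k m n ≡ sum1to m (λ r → s m r * + f k (n ∸ m + r))
-- 2 ≤ k already follows from 1 ≤ m ≤ k ∸ 1.
corollary2p4 k m n _ = h≡stirling-sum k m n
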